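{- Let $a,b$ be coprime positive integers with $\frac ab\le\frac35$, and let $A_{ij}$ be the coefficient of $u^iv^jw^{a+b-1-i-j}$ in the numerator $P_{a/b}(u,v,w)$ of the Markov polynomial $M_{a/b}$. Then the sequence of coefficients $A_{ij}$ at the consecutive integer points $(i,j)$ with $i,j\ge0$, $\frac ia+\frac jb\ge1$ lying on the line $i+j=a+b-3$ is log-concave.
   Context: A sequence $(x_0,\dots,x_m)$ is log-concave if $x_k^2\ge x_{k-1}x_{k+1}$ for all $1\le k\le m-1$. Markov polynomials $M_\rho(x,y,z)$, $\rho\in\mathbb{Q}_{\ge0}\cup\{1/0\}$, are defined recursively by $M_{0/1}=x$, $M_{1/0}=y$, $M_{1/1}=(x^2+y^2)/z$, and: whenever $p/q$, $r/s$ are fractions in lowest terms with $p,q,r,s\ge0$, $qr-ps=1$, mediant $\mu=(p+r)/(q+s)$, then $M_{(2p+r)/(2q+s)}=(M_{p/q}^2+M_\mu^2)/M_{r/s}$ and $M_{(p+2r)/(q+2s)}=(M_\mu^2+M_{r/s}^2)/M_{p/q}$. For coprime positive $a,b$, $M_{a/b}=P_{a/b}(x^2,y^2,z^2)/(x^{a-1}y^{b-1}z^{a+b-1})$ with $P_{a/b}(u,v,w)$ homogeneous of degree $a+b-1$ (the numerator). -}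

module Defs where

open import Data.Nat as ℕ using (ℕ; zero; suc; _∸_; _≤?_)
open import Data.Integer as ℤ using (ℤ; +_; 0ℤ; 1ℤ)
open import Data.List using (List; []; _∷_; filter; map; upTo)
open import Data.Product using (_×_)
open import Data.Unit using (⊤)
open import Relation.Nullary.Decidable using (⌊_⌋)
open import Relation.Binary.PropositionalEquality using (_≡_)
open import Data.Bool using (if_then_else_; _∧_)

-- A series f is its coefficient function: f i j k = coeff of u^i v^j w^k.
-- (Polynomials are the finitely supported ones; ℤ[u,v,w] ⊂ ℤ[[u,v,w]].)

Series : Set
Series = ℕ → ℕ → ℕ → ℤ

sumTo : ℕ → (ℕ → ℤ) → ℤ
sumTo zero    h = h zero
sumTo (suc n) h = sumTo n h ℤ.+ h (suc n)

_⊕_ : Series → Series → Series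
(f ⊕ g) i j k = f i j k ℤ.+ g i j k

_⊗_ : Series → Series → Series
(f ⊗ g) i j k =
  sumTo i λ i₁ → sumTo j λ j₁ → sumTo k λ k₁ →
    f i₁ j₁ k₁ ℤ.* g (i ∸ i₁) (j ∸ j₁) (k ∸ k₁)

infixl 6 _⊕_
infixl 7 _⊗_
infix 4 _≋_

mono : ℕ → ℕ → ℕ → Series
mono r s t i j k =
  if ⌊ i ℕ.≟ r ⌋ ∧ ⌊ j ℕ.≟ s ⌋ ∧ ⌊ k ℕ.≟ t ⌋ then 1ℤ else 0ℤ

_≋_ : Series → Series → Set
f ≋ g = ∀ i j k → f i j k ≡ g i j k

-- Writing M_{a/b} = P_{a/b}(x²,y²,z²) / (x^{a-1} y^{b-1} z^{a+b-1}) uniformly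
-- (this gives P_{0/1} = P_{1/0} = 1 and P_{1/1} = u + v), the defining
-- recursion of the M's, after clearing the (monomial) denominators, is
--   P_{(2p+r)/(2q+s)} · P_{r/s} = u^r v^s w^(r+s) · P_{p/q}² + P_μ²
--   P_{(p+2r)/(q+2s)} · P_{p/q} = P_μ² + u^p v^q w^(p+q) · P_{r/s}²
-- for p,q,r,s ≥ 0 with qr - ps = 1 and μ = (p+r)/(q+s).
-- Since ℤ[[u,v,w]] is an integral domain, these equations determine
-- P_{a/b} uniquely for every coprime a/b.

record IsMarkovNumerators (P : ℕ → ℕ → Series) : Set where
  field
    base01 : P 0 1 ≋ mono 0 0 0
    base10 : P 1 0 ≋ mono 0 0 0
    base11 : P 1 1 ≋ mono 1 0 0 ⊕ mono 0 1 0
    stepL  : ∀ p q r s → q ℕ.* r ≡ p ℕ.* s ℕ.+ 1 →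
             P (2 ℕ.* p ℕ.+ r) (2 ℕ.* q ℕ.+ s) ⊗ P r s
               ≋ mono r s (r ℕ.+ s) ⊗ (P p q ⊗ P p q)
                 ⊕ P (p ℕ.+ r) (q ℕ.+ s) ⊗ P (p ℕ.+ r) (q ℕ.+ s)
    stepR  : ∀ p q r s → q ℕ.* r ≡ p ℕ.* s ℕ.+ 1 →
             P (p ℕ.+ 2 ℕ.* r) (q ℕ.+ 2 ℕ.* s) ⊗ P p q
               ≋ P (p ℕ.+ r) (q ℕ.+ s) ⊗ P (p ℕ.+ r) (q ℕ.+ s)
                 ⊕ mono p q (p ℕ.+ q) ⊗ (P r s ⊗ P r s)

coeffA : (ℕ → ℕ → Series) → ℕ → ℕ → ℕ → ℕ → ℤ
coeffA P a b i j = P a b i j (a ℕ.+ b ∸ 1 ∸ i ∸ j)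

LogConcave : List ℤ → Set
LogConcave (x ∷ y ∷ z ∷ rest) = (x ℤ.* z ℤ.≤ y ℤ.* y) × LogConcave (y ∷ z ∷ rest)
LogConcave _ = ⊤

-- The integer points (i,j), i,j ≥ 0, on the line i + j = N := a+b-3 with
-- i/a + j/b ≥ 1 (i.e. i·b + j·a ≥ a·b, as a,b > 0), listed consecutively
-- along the line (by increasing i), and the sequence of A_{ij} there.
lineSeq : (ℕ → ℕ → Series) → ℕ → ℕ → List ℤ
lineSeq P a b =
  map (λ i → coeffA P a b i (N ∸ i))
      (filter (λ i → a ℕ.* b ≤? i ℕ.* b ℕ.+ (N ∸ i) ℕ.* a) (upTo (suc N)))
  where
  N : ℕ
  N = a ℕ.+ b ∸ 3

-- Write a = 1 + A, b = 1 + B and S = u + v.  For coprime 0 < a < b the numerator satisfies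
--   P_{a/b} ≡ S^(a+b-1) + w S^(a+b-3) L + w² S^(a+b-5) Q   (mod w³),
-- L = A v + B u,  Q = C(A,2) v² + (AB + B − 3A − 1) uv + C(B,2) u².
-- This is proved down the Stern–Brocot tree.  In the recursion P₁ P₂ = m P_{p/q}² + P_μ² the monomial
-- m = u^r v^s w^(r+s) dies modulo w³ except at the boundary nodes r/s = 1/1 and p/q = 0/1; away from them
-- the expansion is additive along mediants, and since u + v is not a zero divisor the products can be
-- cancelled.  The coefficients A_{ij} on the line i + j = a + b − 3 are the w² part, i.e. the coefficients
-- of S^(a+b-5) Q: the triple (C(A,2), a(b−4) + 2, C(B,2)) convolved a + b − 5 times with (1, 1).  For
-- 5a ≤ 3b the triple is log-concave, convolution with (1, 1) preserves log-concavity of sequences without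
-- internal zeros, and the points with i/a + j/b ≥ 1 form a contiguous window of the line.

module Submission where

import Data.Integer.Properties as ℤ
open import Algebra.Bundles using (CommutativeRing)
open import Algebra.Solver.Ring.AlmostCommutativeRing using (fromCommutativeRing; _-Raw-AlmostCommutative⟶_)
open import Data.Nat using (ℕ; _≤_)
open import Level using (0ℓ)

-- Power series over R compared only in the degrees satisfying Kept (a down-closed set):
-- Kept n = n < d gives R[x]/(xᵈ), Kept n = ⊤ gives R[[x]].
module TruncatedPowerSeries (R : CommutativeRing 0ℓ 0ℓ) (Kept : ℕ → Set)
  (kept-down : ∀ {m n} → m ≤ n → Kept n → Kept m) where

  open import Data.Nat as ℕ using (ℕ; zero; suc; _∸_; _≤_; z≤n)
  open import Data.Nat.Properties using (≤-refl; ≤-trans; n≤1+n; m∸n≤m; m∸[m∸n]≡n;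
    n∸n≡0; +-∸-assoc; +-suc; m+[n∸m]≡n; m+n∸m≡n; ∸-+-assoc)
    renaming (+-identityʳ to ℕ-+-identityʳ)
  open import Data.Product using (_,_)
  open import Algebra.Structures using (IsCommutativeRing)
  import Relation.Binary.PropositionalEquality as ≡
  open CommutativeRing R hiding (zero; isCommutativeRing)
  open import Relation.Binary.Reasoning.Setoid setoid

  Σ : ℕ → (ℕ → Carrier) → Carrier
  Σ zero    h = h zero
  Σ (suc n) h = Σ n h + h (suc n)

  Σ-cong : ∀ n {h h′} → (∀ i → i ≤ n → h i ≈ h′ i) → Σ n h ≈ Σ n h′
  Σ-cong zero    e = e zero z≤n
  Σ-cong (suc n) e = +-cong (Σ-cong n (λ i i≤n → e i (≤-trans i≤n (n≤1+n n)))) (e (suc n) ≤-refl)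

  Σ-+ : ∀ n h h′ → Σ n (λ i → h i + h′ i) ≈ Σ n h + Σ n h′
  Σ-+ zero    h h′ = refl
  Σ-+ (suc n) h h′ = begin
    Σ n (λ i → h i + h′ i) + (h (suc n) + h′ (suc n)) ≈⟨ +-congʳ (Σ-+ n h h′) ⟩
    (Σ n h + Σ n h′) + (h (suc n) + h′ (suc n))        ≈⟨ +-assoc _ _ _ ⟩
    Σ n h + (Σ n h′ + (h (suc n) + h′ (suc n)))        ≈⟨ +-congˡ (sym (+-assoc _ _ _)) ⟩
    Σ n h + ((Σ n h′ + h (suc n)) + h′ (suc n))        ≈⟨ +-congˡ (+-congʳ (+-comm _ _)) ⟩
    Σ n h + ((h (suc n) + Σ n h′) + h′ (suc n))        ≈⟨ +-congˡ (+-assoc _ _ _) ⟩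
    Σ n h + (h (suc n) + (Σ n h′ + h′ (suc n)))        ≈⟨ sym (+-assoc _ _ _) ⟩
    (Σ n h + h (suc n)) + (Σ n h′ + h′ (suc n))        ∎

  *-distribˡ-Σ : ∀ n c h → c * Σ n h ≈ Σ n (λ i → c * h i)
  *-distribˡ-Σ zero    c h = refl
  *-distribˡ-Σ (suc n) c h = trans (distribˡ c _ _) (+-congʳ (*-distribˡ-Σ n c h))

  *-distribʳ-Σ : ∀ n c h → Σ n h * c ≈ Σ n (λ i → h i * c)
  *-distribʳ-Σ zero    c h = refl
  *-distribʳ-Σ (suc n) c h = trans (distribʳ c _ _) (+-congʳ (*-distribʳ-Σ n c h))

  Σ-zero : ∀ n h → (∀ i → i ≤ n → h i ≈ 0#) → Σ n h ≈ 0#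
  Σ-zero n h e = trans (Σ-cong n e) (sum-of-zeros n)
    where
    sum-of-zeros : ∀ n → Σ n (λ _ → 0#) ≈ 0#
    sum-of-zeros zero    = refl
    sum-of-zeros (suc n) = trans (+-congʳ (sum-of-zeros n)) (+-identityˡ 0#)

  Σ-unfoldˡ : ∀ n h → Σ (suc n) h ≈ h zero + Σ n (λ i → h (suc i))
  Σ-unfoldˡ zero    h = refl
  Σ-unfoldˡ (suc n) h = trans (+-congʳ (Σ-unfoldˡ n h)) (+-assoc _ _ _)

  Σ-reverse : ∀ n h → Σ n h ≈ Σ n (λ i → h (n ∸ i))
  Σ-reverse zero    h = refl
  Σ-reverse (suc n) h = begin
    Σ n h + h (suc n)                 ≈⟨ +-comm _ _ ⟩
    h (suc n) + Σ n h                 ≈⟨ +-congˡ (Σ-reverse n h) ⟩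
    h (suc n) + Σ n (λ i → h (n ∸ i)) ≈⟨ sym (Σ-unfoldˡ n (λ i → h (suc n ∸ i))) ⟩
    Σ (suc n) (λ i → h (suc n ∸ i))   ∎

  Σ-triangle : ∀ n (F : ℕ → ℕ → Carrier) →
    Σ n (λ i → Σ i (λ j → F i j)) ≈ Σ n (λ j → Σ (n ∸ j) (λ k → F (j ℕ.+ k) j))
  Σ-triangle zero    F = refl
  Σ-triangle (suc n) F = begin
    Σ n (λ i → Σ i (F i)) + (Σ n (F (suc n)) + F (suc n) (suc n))
      ≈⟨ trans (sym (+-assoc _ _ _)) (+-congʳ (+-congʳ (Σ-triangle n F))) ⟩
    (Σ n (λ j → Σ (n ∸ j) (λ k → F (j ℕ.+ k) j)) + Σ n (F (suc n))) + F (suc n) (suc n)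
      ≈⟨ +-congʳ (sym (Σ-+ n _ _)) ⟩
    Σ n (λ j → Σ (n ∸ j) (λ k → F (j ℕ.+ k) j) + F (suc n) j) + F (suc n) (suc n)
      ≈⟨ +-cong (Σ-cong n extend) (reflexive (≡.cong (λ t → F t (suc n)) (≡.sym (ℕ-+-identityʳ (suc n))))) ⟩
    Σ n (λ j → Σ (suc n ∸ j) (λ k → F (j ℕ.+ k) j)) + F (suc n ℕ.+ 0) (suc n)
      ≈⟨ +-congˡ (reflexive (≡.cong (λ t → Σ t (λ k → F (suc n ℕ.+ k) (suc n))) (≡.sym (n∸n≡0 n)))) ⟩
    Σ n (λ j → Σ (suc n ∸ j) (λ k → F (j ℕ.+ k) j)) + Σ (n ∸ n) (λ k → F (suc n ℕ.+ k) (suc n)) ∎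
    where
    extend : ∀ j → j ≤ n →
      Σ (n ∸ j) (λ k → F (j ℕ.+ k) j) + F (suc n) j ≈ Σ (suc n ∸ j) (λ k → F (j ℕ.+ k) j)
    extend j j≤n rewrite +-∸-assoc 1 j≤n =
      +-congˡ (reflexive (≡.cong (λ t → F t j) (≡.sym (≡.trans (+-suc j (n ∸ j)) (≡.cong suc (m+[n∸m]≡n j≤n))))))

  PowerSeries : Set
  PowerSeries = ℕ → Carrier

  infix 4 _≈ₚ_
  _≈ₚ_ : PowerSeries → PowerSeries → Set
  f ≈ₚ g = ∀ n → Kept n → f n ≈ g n

  _+ₚ_ : PowerSeries → PowerSeries → PowerSeries
  (f +ₚ g) n = f n + g n

  _*ₚ_ : PowerSeries → PowerSeries → PowerSeries
  (f *ₚ g) n = Σ n (λ i → f i * g (n ∸ i))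

  -ₚ_ : PowerSeries → PowerSeries
  (-ₚ f) n = - f n

  0ₚ : PowerSeries
  0ₚ n = 0#

  1ₚ : PowerSeries
  1ₚ zero    = 1#
  1ₚ (suc n) = 0#

  private
    *ₚ-comm : ∀ f g n → (f *ₚ g) n ≈ (g *ₚ f) n
    *ₚ-comm f g n = begin
      Σ n (λ i → f i * g (n ∸ i))             ≈⟨ Σ-reverse n _ ⟩
      Σ n (λ i → f (n ∸ i) * g (n ∸ (n ∸ i))) ≈⟨ Σ-cong n (λ i i≤n → trans (*-comm _ _) (*-congʳ (reflexive (≡.cong g (m∸[m∸n]≡n i≤n))))) ⟩
      Σ n (λ i → g i * f (n ∸ i))             ∎

    *ₚ-cong : ∀ {f f′ g g′} → f ≈ₚ f′ → g ≈ₚ g′ → (f *ₚ g) ≈ₚ (f′ *ₚ g′)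
    *ₚ-cong f≈f′ g≈g′ n kept =
      Σ-cong n (λ i i≤n → *-cong (f≈f′ i (kept-down i≤n kept)) (g≈g′ (n ∸ i) (kept-down (m∸n≤m n i) kept)))

    *ₚ-assoc : ∀ f g h n → ((f *ₚ g) *ₚ h) n ≈ (f *ₚ (g *ₚ h)) n
    *ₚ-assoc f g h n = begin
      Σ n (λ i → Σ i (λ j → f j * g (i ∸ j)) * h (n ∸ i))
        ≈⟨ Σ-cong n (λ i _ → *-distribʳ-Σ i _ _) ⟩
      Σ n (λ i → Σ i (λ j → f j * g (i ∸ j) * h (n ∸ i)))
        ≈⟨ Σ-triangle n (λ i j → f j * g (i ∸ j) * h (n ∸ i)) ⟩
      Σ n (λ j → Σ (n ∸ j) (λ k → f j * g (j ℕ.+ k ∸ j) * h (n ∸ (j ℕ.+ k))))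
        ≈⟨ Σ-cong n (λ j _ → Σ-cong (n ∸ j) (λ k _ → trans (*-assoc _ _ _)
             (*-congˡ (reflexive (≡.cong₂ (λ x y → g x * h y) (m+n∸m≡n j k) (≡.sym (∸-+-assoc n j k))))))) ⟩
      Σ n (λ j → Σ (n ∸ j) (λ k → f j * (g k * h (n ∸ j ∸ k))))
        ≈⟨ Σ-cong n (λ j _ → sym (*-distribˡ-Σ (n ∸ j) _ _)) ⟩
      Σ n (λ j → f j * Σ (n ∸ j) (λ k → g k * h (n ∸ j ∸ k))) ∎

    *ₚ-identityˡ : ∀ f n → (1ₚ *ₚ f) n ≈ f n
    *ₚ-identityˡ f zero    = *-identityˡ _
    *ₚ-identityˡ f (suc n) = begin
      Σ (suc n) (λ i → 1ₚ i * f (suc n ∸ i))       ≈⟨ Σ-unfoldˡ n _ ⟩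
      1# * f (suc n) + Σ n (λ i → 0# * f (n ∸ i)) ≈⟨ +-cong (*-identityˡ _) (Σ-zero n _ (λ i _ → zeroˡ _)) ⟩
      f (suc n) + 0#                               ≈⟨ +-identityʳ _ ⟩
      f (suc n)                                    ∎

    *ₚ-distribˡ : ∀ f g h n → (f *ₚ (g +ₚ h)) n ≈ ((f *ₚ g) +ₚ (f *ₚ h)) n
    *ₚ-distribˡ f g h n = trans (Σ-cong n (λ i _ → distribˡ _ _ _)) (Σ-+ n _ _)

  isCommutativeRing : IsCommutativeRing _≈ₚ_ _+ₚ_ _*ₚ_ -ₚ_ 0ₚ 1ₚ
  isCommutativeRing = record
    { isRing = record
      { +-isAbelianGroup = record
        { isGroup = record
          { isMonoid = record
            { isSemigroup = record
              { isMagma = record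
                { isEquivalence = record
                  { refl  = λ _ _ → refl
                  ; sym   = λ e n k → sym (e n k)
                  ; trans = λ e e′ n k → trans (e n k) (e′ n k) }
                ; ∙-cong = λ e e′ n k → +-cong (e n k) (e′ n k) }
              ; assoc = λ _ _ _ _ _ → +-assoc _ _ _ }
            ; identity = (λ _ _ _ → +-identityˡ _) , (λ _ _ _ → +-identityʳ _) }
          ; inverse = (λ _ _ _ → -‿inverseˡ _) , (λ _ _ _ → -‿inverseʳ _)
          ; ⁻¹-cong = λ e n k → -‿cong (e n k) }
        ; comm = λ _ _ _ _ → +-comm _ _ }
      ; *-cong = *ₚ-cong
      ; *-assoc = λ f g h n _ → *ₚ-assoc f g h n
      ; *-identity = (λ f n _ → *ₚ-identityˡ f n) , (λ f n _ → trans (*ₚ-comm f 1ₚ n) (*ₚ-identityˡ f n))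
      ; distrib = (λ f g h n _ → *ₚ-distribˡ f g h n)
                , (λ f g h n _ → trans (*ₚ-comm (g +ₚ h) f n)
                                   (trans (*ₚ-distribˡ f g h n) (+-cong (*ₚ-comm f g n) (*ₚ-comm f h n))))
      }
    ; *-comm = λ f g n _ → *ₚ-comm f g n
    }

  commutativeRing : CommutativeRing 0ℓ 0ℓ
  commutativeRing = record { isCommutativeRing = isCommutativeRing }

  constant : Carrier → PowerSeries
  constant c zero    = c
  constant c (suc n) = 0#

  constant-cong : ∀ {x y} → x ≈ y → constant x ≈ₚ constant y
  constant-cong e zero    _ = e
  constant-cong e (suc n) _ = refl

  constant-+ : ∀ x y → constant (x + y) ≈ₚ constant x +ₚ constant y
  constant-+ x y zero    _ = refl
  constant-+ x y (suc n) _ = sym (+-identityˡ 0#)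

  constant-* : ∀ x y → constant (x * y) ≈ₚ constant x *ₚ constant y
  constant-* x y zero    _ = refl
  constant-* x y (suc n) _ = sym (begin
    Σ (suc n) (λ i → constant x i * constant y (suc n ∸ i))   ≈⟨ Σ-unfoldˡ n _ ⟩
    x * 0# + Σ n (λ i → 0# * constant y (n ∸ i))              ≈⟨ +-cong (zeroʳ x) (Σ-zero n _ (λ i _ → zeroˡ _)) ⟩
    0# + 0#                                                   ≈⟨ +-identityˡ 0# ⟩
    0#                                                        ∎)

  constant-neg : ∀ x → constant (- x) ≈ₚ -ₚ constant x
  constant-neg x zero    _ = refl
  constant-neg x (suc n) _ = sym (trans (sym (+-identityʳ (- 0#))) (-‿inverseˡ 0#))

module SeriesRing where

  open import Level using (0ℓ)
  open import Algebra.Bundles using (CommutativeRing)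
  open import Data.Nat as ℕ using (ℕ; zero; suc; _∸_; _<_; s≤s)
  import Data.Nat.Properties as ℕ
  open import Data.Integer as ℤ using (ℤ; +_)
  import Data.Integer.Properties as ℤ
  open import Data.Unit using (⊤; tt)
  open import Relation.Binary.PropositionalEquality using (_≡_; refl; cong; cong₂; sym; trans; module ≡-Reasoning)
  open import Algebra.Solver.Ring.AlmostCommutativeRing using (fromCommutativeRing; _-Raw-AlmostCommutative⟶_)
  open import Defs

  -- ℤ[[u,v,w]]/(w³), as ((ℤ[w]/w³)[[v]])[[u]]; a series f is read as f i j k.
  private
    module W = TruncatedPowerSeries ℤ.+-*-commutativeRing (_< 3) (λ m≤n n<3 → ℕ.≤-trans (s≤s m≤n) n<3)
    module V = TruncatedPowerSeries W.commutativeRing (λ _ → ⊤) (λ _ _ → tt)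
    module U = TruncatedPowerSeries V.commutativeRing (λ _ → ⊤) (λ _ _ → tt)

  seriesRing : CommutativeRing 0ℓ 0ℓ
  seriesRing = U.commutativeRing

  open CommutativeRing seriesRing public
    using (_≈_; _+_; _*_; -_; 0#; 1#; +-cong; +-congˡ; +-congʳ; *-congˡ; *-congʳ; *-comm; *-assoc;
           distribˡ; distribʳ; *-identityˡ; *-identityʳ)
    renaming (refl to ≈-refl; sym to ≈-sym; trans to ≈-trans)

  at : ∀ {f g} → f ≈ g → ∀ i j k → k < 3 → f i j k ≡ g i j k
  at f≈g i j k k<3 = f≈g i tt j tt k k<3

  ≋⇒≈ : ∀ {f g} → f ≋ g → f ≈ g
  ≋⇒≈ f≋g i _ j _ k _ = f≋g i j k

  private
    sumTo-cong : ∀ n {h h′} → (∀ i → h i ≡ h′ i) → sumTo n h ≡ sumTo n h′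
    sumTo-cong zero    e = e zero
    sumTo-cong (suc n) e = cong₂ ℤ._+_ (sumTo-cong n e) (e (suc n))

    ΣU : ∀ n (h : ℕ → V.PowerSeries) j → U.Σ n h j ≡ V.Σ n (λ i → h i j)
    ΣU zero    h j = refl
    ΣU (suc n) h j = cong (λ x → x W.+ₚ h (suc n) j) (ΣU n h j)

    ΣV : ∀ n (h : ℕ → W.PowerSeries) k → V.Σ n h k ≡ W.Σ n (λ i → h i k)
    ΣV zero    h k = refl
    ΣV (suc n) h k = cong (λ x → x ℤ.+ h (suc n) k) (ΣV n h k)

    ΣW : ∀ n h → W.Σ n h ≡ sumTo n h
    ΣW zero    h = refl
    ΣW (suc n) h = cong (λ x → x ℤ.+ h (suc n)) (ΣW n h)

  ⊗-coeff : ∀ f g i j k → (f ⊗ g) i j k ≡ (f * g) i j k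
  ⊗-coeff f g i j k = sym (begin
    U.Σ i (λ i₁ → f i₁ V.*ₚ g (i ∸ i₁)) j k            ≡⟨ cong (λ x → x k) (ΣU i _ j) ⟩
    V.Σ i (λ i₁ → (f i₁ V.*ₚ g (i ∸ i₁)) j) k          ≡⟨ ΣV i _ k ⟩
    W.Σ i (λ i₁ → (f i₁ V.*ₚ g (i ∸ i₁)) j k)          ≡⟨ ΣW i _ ⟩
    sumTo i (λ i₁ → V.Σ j (λ j₁ → f i₁ j₁ W.*ₚ g (i ∸ i₁) (j ∸ j₁)) k)
      ≡⟨ sumTo-cong i (λ i₁ → trans (ΣV j _ k) (trans (ΣW j _) (sumTo-cong j (λ j₁ → ΣW k _)))) ⟩
    (f ⊗ g) i j k                                       ∎)
    where open ≡-Reasoning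

  ⊗-is-* : ∀ f g → f ⊗ g ≈ f * g
  ⊗-is-* f g i _ j _ k _ = ⊗-coeff f g i j k

  ι : ℤ → Series
  ι c = U.constant (V.constant (W.constant c))

  private
    ι-+ : ∀ x y → ι (x ℤ.+ y) ≈ ι x + ι y
    ι-+ x y = ≈-trans (U.constant-cong (V.constant-cong (W.constant-+ x y)))
                      (≈-trans (U.constant-cong (V.constant-+ _ _)) (U.constant-+ _ _))

    ι-* : ∀ x y → ι (x ℤ.* y) ≈ ι x * ι y
    ι-* x y = ≈-trans (U.constant-cong (V.constant-cong (W.constant-* x y)))
                      (≈-trans (U.constant-cong (V.constant-* _ _)) (U.constant-* _ _))

    ι-neg : ∀ x → ι (ℤ.- x) ≈ - ι x
    ι-neg x = ≈-trans (U.constant-cong (V.constant-cong (W.constant-neg x)))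
                      (≈-trans (U.constant-cong (V.constant-neg _)) (U.constant-neg _))

    ι-0 : ι (+ 0) ≈ 0#
    ι-0 zero    _ zero    _ zero    _ = refl
    ι-0 zero    _ zero    _ (suc k) _ = refl
    ι-0 zero    _ (suc j) _ k       _ = refl
    ι-0 (suc i) _ j       _ k       _ = refl

    ι-1 : ι (+ 1) ≈ 1#
    ι-1 zero    _ zero    _ zero    _ = refl
    ι-1 zero    _ zero    _ (suc k) _ = refl
    ι-1 zero    _ (suc j) _ k       _ = refl
    ι-1 (suc i) _ j       _ k       _ = refl

  ι-morphism : CommutativeRing.rawRing ℤ.+-*-commutativeRing -Raw-AlmostCommutative⟶ fromCommutativeRing seriesRing
  ι-morphism = record { ⟦_⟧ = ι ; +-homo = ι-+ ; *-homo = ι-* ; -‿homo = ι-neg ; 0-homo = ι-0 ; 1-homo = ι-1 }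

module Monomials where

  open import Data.Nat as ℕ using (ℕ; zero; suc; _∸_; _≤_; _<_; z≤n; s≤s)
  import Data.Nat.Properties as ℕ
  open import Data.Integer as ℤ using (ℤ; 0ℤ; 1ℤ)
  import Data.Integer.Properties as ℤ
  open import Data.Bool using (true; false; _∧_; if_then_else_)
  open import Data.Sum using (_⊎_; inj₁; inj₂) renaming (map to ⊎-map)
  open import Relation.Nullary using (Dec; yes; no; ¬_)
  open import Relation.Nullary.Decidable using (isYes; dec-true; dec-false; does-⇔; isYes≗does)
  open import Function.Bundles using (mk⇔)
  open import Relation.Binary.PropositionalEquality using (_≡_; _≢_; refl; cong; cong₂; sym; trans)
  open import Defs

  private
    isYes-true : ∀ {A : Set} (a? : Dec A) → A → isYes a? ≡ true
    isYes-true a? a = trans (isYes≗does a?) (dec-true a? a)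

    isYes-false : ∀ {A : Set} (a? : Dec A) → ¬ A → isYes a? ≡ false
    isYes-false a? ¬a = trans (isYes≗does a?) (dec-false a? ¬a)

    indicator-false : ∀ b₁ b₂ b₃ → b₁ ≡ false ⊎ b₂ ≡ false ⊎ b₃ ≡ false →
                      (if b₁ ∧ b₂ ∧ b₃ then 1ℤ else 0ℤ) ≡ 0ℤ
    indicator-false false _     _     _                  = refl
    indicator-false true  false _     _                  = refl
    indicator-false true  true  false _                  = refl
    indicator-false true  true  true  (inj₁ ())
    indicator-false true  true  true  (inj₂ (inj₁ ()))
    indicator-false true  true  true  (inj₂ (inj₂ ()))

  mono-off : ∀ r s t i j k → i ≢ r ⊎ j ≢ s ⊎ k ≢ t → mono r s t i j k ≡ 0ℤ
  mono-off r s t i j k off =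
    indicator-false _ _ _ (⊎-map (isYes-false (i ℕ.≟ r)) (⊎-map (isYes-false (j ℕ.≟ s)) (isYes-false (k ℕ.≟ t))) off)

  mono-on : ∀ r s t → mono r s t r s t ≡ 1ℤ
  mono-on r s t rewrite isYes-true (r ℕ.≟ r) refl | isYes-true (s ℕ.≟ s) refl | isYes-true (t ℕ.≟ t) refl = refl

  sumTo-zero : ∀ n (h : ℕ → ℤ) → (∀ x → x ≤ n → h x ≡ 0ℤ) → sumTo n h ≡ 0ℤ
  sumTo-zero zero    h h≡0 = h≡0 zero z≤n
  sumTo-zero (suc n) h h≡0 =
    cong₂ ℤ._+_ (sumTo-zero n h (λ x x≤n → h≡0 x (ℕ.≤-trans x≤n (ℕ.n≤1+n n)))) (h≡0 (suc n) ℕ.≤-refl)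

  sumTo-single : ∀ n r (h : ℕ → ℤ) → (∀ x → x ≢ r → h x ≡ 0ℤ) → r ≤ n → sumTo n h ≡ h r
  sumTo-single zero    .zero h h≡0 z≤n = refl
  sumTo-single (suc n) r     h h≡0 r≤1+n with r ℕ.≟ suc n
  ... | yes refl = trans (cong (ℤ._+ h (suc n)) (sumTo-zero n h (λ x x≤n → h≡0 x (λ { refl → ℕ.<-irrefl refl (s≤s x≤n) }))))
                         (ℤ.+-identityˡ _)
  ... | no r≢1+n = trans (cong₂ ℤ._+_ (sumTo-single n r h h≡0 (ℕ.≤-pred (ℕ.≤∧≢⇒< r≤1+n r≢1+n))) (h≡0 (suc n) (λ e → r≢1+n (sym e))))
                         (ℤ.+-identityʳ _)

  sumTo-none : ∀ n r (h : ℕ → ℤ) → (∀ x → x ≢ r → h x ≡ 0ℤ) → n < r → sumTo n h ≡ 0ℤ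
  sumTo-none n r h h≡0 n<r = sumTo-zero n h (λ x x≤n → h≡0 x (λ { refl → ℕ.<-irrefl refl (ℕ.≤-<-trans x≤n n<r) }))

  private
    zero-* : ∀ {a} b → a ≡ 0ℤ → a ℤ.* b ≡ 0ℤ
    zero-* b refl = ℤ.*-zeroˡ b

  mono-⊗ : ∀ r s t X i j k → r ≤ i → s ≤ j → t ≤ k →
           (mono r s t ⊗ X) i j k ≡ X (i ∸ r) (j ∸ s) (k ∸ t)
  mono-⊗ r s t X i j k r≤i s≤j t≤k =
    trans (sumTo-single i r _ (λ x x≢r → sumTo-zero j _ (λ y _ → sumTo-zero k _ (λ z _ → zero-* _ (mono-off r s t x y z (inj₁ x≢r))))) r≤i)
    (trans (sumTo-single j s _ (λ y y≢s → sumTo-zero k _ (λ z _ → zero-* _ (mono-off r s t r y z (inj₂ (inj₁ y≢s))))) s≤j)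
    (trans (sumTo-single k t _ (λ z z≢t → zero-* _ (mono-off r s t r s z (inj₂ (inj₂ z≢t)))) t≤k)
    (trans (cong (ℤ._* X (i ∸ r) (j ∸ s) (k ∸ t)) (mono-on r s t)) (ℤ.*-identityˡ _))))

  mono-⊗-below : ∀ r s t X i j k → i < r ⊎ j < s ⊎ k < t → (mono r s t ⊗ X) i j k ≡ 0ℤ
  mono-⊗-below r s t X i j k (inj₁ i<r) =
    sumTo-none i r _ (λ x x≢r → sumTo-zero j _ (λ y _ → sumTo-zero k _ (λ z _ → zero-* _ (mono-off r s t x y z (inj₁ x≢r))))) i<r
  mono-⊗-below r s t X i j k (inj₂ (inj₁ j<s)) =
    sumTo-zero i _ (λ x _ → sumTo-none j s _ (λ y y≢s → sumTo-zero k _ (λ z _ → zero-* _ (mono-off r s t x y z (inj₂ (inj₁ y≢s))))) j<s)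
  mono-⊗-below r s t X i j k (inj₂ (inj₂ k<t)) =
    sumTo-zero i _ (λ x _ → sumTo-zero j _ (λ y _ → sumTo-none k t _ (λ z z≢t → zero-* _ (mono-off r s t x y z (inj₂ (inj₂ z≢t)))) k<t))

  private
    shifted-≟ : ∀ r r′ i → r ≤ i → isYes ((i ∸ r) ℕ.≟ r′) ≡ isYes (i ℕ.≟ r ℕ.+ r′)
    shifted-≟ r r′ i r≤i = trans (isYes≗does ((i ∸ r) ℕ.≟ r′))
      (trans (does-⇔ (mk⇔ to from) ((i ∸ r) ℕ.≟ r′) (i ℕ.≟ r ℕ.+ r′)) (sym (isYes≗does (i ℕ.≟ r ℕ.+ r′))))
      where
      to : i ∸ r ≡ r′ → i ≡ r ℕ.+ r′
      to refl = sym (ℕ.m+[n∸m]≡n r≤i)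
      from : i ≡ r ℕ.+ r′ → i ∸ r ≡ r′
      from refl = ℕ.m+n∸m≡n r r′

    below-sum : ∀ {i r r′} → i < r → i ≢ r ℕ.+ r′
    below-sum {r = r} {r′} i<r refl = ℕ.<-irrefl refl (ℕ.<-≤-trans i<r (ℕ.m≤m+n r r′))

  mono-⊗-mono : ∀ r s t r′ s′ t′ → mono r s t ⊗ mono r′ s′ t′ ≋ mono (r ℕ.+ r′) (s ℕ.+ s′) (t ℕ.+ t′)
  mono-⊗-mono r s t r′ s′ t′ i j k with r ℕ.≤? i | s ℕ.≤? j | t ℕ.≤? k
  ... | yes r≤i | yes s≤j | yes t≤k = trans (mono-⊗ r s t (mono r′ s′ t′) i j k r≤i s≤j t≤k)
        (cong₂ (λ a b → if a ∧ b then 1ℤ else 0ℤ) (shifted-≟ r r′ i r≤i)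
               (cong₂ _∧_ (shifted-≟ s s′ j s≤j) (shifted-≟ t t′ k t≤k)))
  ... | no r≰i | _ | _ = trans (mono-⊗-below r s t (mono r′ s′ t′) i j k (inj₁ (ℕ.≰⇒> r≰i)))
        (sym (mono-off _ _ _ i j k (inj₁ (below-sum (ℕ.≰⇒> r≰i)))))
  ... | yes _ | no s≰j | _ = trans (mono-⊗-below r s t (mono r′ s′ t′) i j k (inj₂ (inj₁ (ℕ.≰⇒> s≰j))))
        (sym (mono-off _ _ _ i j k (inj₂ (inj₁ (below-sum (ℕ.≰⇒> s≰j))))))
  ... | yes _ | yes _ | no t≰k = trans (mono-⊗-below r s t (mono r′ s′ t′) i j k (inj₂ (inj₂ (ℕ.≰⇒> t≰k))))
        (sym (mono-off _ _ _ i j k (inj₂ (inj₂ (below-sum (ℕ.≰⇒> t≰k))))))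

module Variables where

  open import Algebra.Bundles using (CommutativeRing)
  open import Data.Nat as ℕ using (ℕ; zero; suc; _≤_; _<_; z≤n; s≤s)
  import Data.Nat.Properties as ℕ
  open import Data.Integer as ℤ using (ℤ; 0ℤ)
  import Data.Integer.Properties as ℤ
  open import Data.Sum using (inj₁; inj₂)
  open import Relation.Binary.PropositionalEquality using (_≡_; refl; cong₂; sym; trans)
  open import Defs
  open Monomials
  open SeriesRing
  open import Algebra.Properties.Semiring.Exp (CommutativeRing.semiring seriesRing) using (_^_)
  open import Algebra.Properties.CommutativeSemigroup (CommutativeRing.*-commutativeSemigroup seriesRing) using (x∙yz≈y∙xz)

  u v w : Series
  u = mono 1 0 0
  v = mono 0 1 0
  w = mono 0 0 1

  mono-* : ∀ r s t r′ s′ t′ → mono r s t * mono r′ s′ t′ ≈ mono (r ℕ.+ r′) (s ℕ.+ s′) (t ℕ.+ t′)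
  mono-* r s t r′ s′ t′ = ≈-trans (≈-sym (⊗-is-* (mono r s t) (mono r′ s′ t′))) (≋⇒≈ (mono-⊗-mono r s t r′ s′ t′))

  mono-000 : mono 0 0 0 ≈ 1#
  mono-000 zero    _ zero    _ zero    _ = refl
  mono-000 zero    _ zero    _ (suc k) _ = refl
  mono-000 zero    _ (suc j) _ k       _ = refl
  mono-000 (suc i) _ j       _ k       _ = refl

  mono-vanishes : ∀ r s t → 3 ≤ t → mono r s t ≈ 0#
  mono-vanishes r s t 3≤t i _ j _ k k<3 = mono-off r s t i j k (inj₂ (inj₂ (λ { refl → ℕ.<-irrefl refl (ℕ.<-≤-trans k<3 3≤t) })))

  w³≈0 : w * (w * w) ≈ 0#
  w³≈0 = ≈-trans (*-congˡ {w} (mono-* 0 0 1 0 0 1)) (≈-trans (mono-* 0 0 1 0 0 2) (mono-vanishes 0 0 3 ℕ.≤-refl))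

  u-shift : ∀ X i j k → (u * X) (suc i) j k ≡ X i j k
  u-shift X i j k = trans (sym (⊗-coeff u X (suc i) j k)) (mono-⊗ 1 0 0 X (suc i) j k (s≤s z≤n) z≤n z≤n)

  u-zero : ∀ X j k → (u * X) zero j k ≡ 0ℤ
  u-zero X j k = trans (sym (⊗-coeff u X zero j k)) (mono-⊗-below 1 0 0 X zero j k (inj₁ (s≤s z≤n)))

  v-shift : ∀ X i j k → (v * X) i (suc j) k ≡ X i j k
  v-shift X i j k = trans (sym (⊗-coeff v X i (suc j) k)) (mono-⊗ 0 1 0 X i (suc j) k z≤n (s≤s z≤n) z≤n)

  v-zero : ∀ X i k → (v * X) i zero k ≡ 0ℤ
  v-zero X i k = trans (sym (⊗-coeff v X i zero k)) (mono-⊗-below 0 1 0 X i zero k (inj₂ (inj₁ (s≤s z≤n))))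

  w-shift : ∀ X i j k → (w * X) i j (suc k) ≡ X i j k
  w-shift X i j k = trans (sym (⊗-coeff w X i j (suc k))) (mono-⊗ 0 0 1 X i j (suc k) z≤n z≤n (s≤s z≤n))

  -- Coefficientwise, X (u + v) = 0 says X(i-1, j+1) + X(i, j) = 0, and X(-1, ·) = 0 starts an induction on i.
  u+v-regular : ∀ X → X * (u + v) ≈ 0# → X ≈ 0#
  u+v-regular X X[u+v]≈0 i _ j _ k k<3 = vanish i j
    where
    uX+vX≡0 : ∀ i j → (u * X) i j k ℤ.+ (v * X) i j k ≡ 0ℤ
    uX+vX≡0 i j = trans (sym (trans (at (distribˡ X u v) i j k k<3)
                                     (cong₂ ℤ._+_ (at (*-comm X u) i j k k<3) (at (*-comm X v) i j k k<3))))
                        (at X[u+v]≈0 i j k k<3)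
    vanish : ∀ i j → X i j k ≡ 0ℤ
    vanish zero    j = trans (sym (ℤ.+-identityˡ _))
      (trans (cong₂ ℤ._+_ (sym (u-zero X (suc j) k)) (sym (v-shift X zero j k))) (uX+vX≡0 zero (suc j)))
    vanish (suc i) j = trans (sym (ℤ.+-identityˡ _))
      (trans (cong₂ ℤ._+_ (trans (sym (vanish i (suc j))) (sym (u-shift X i (suc j) k))) (sym (v-shift X (suc i) j k)))
             (uX+vX≡0 (suc i) (suc j)))

  mono-power : ∀ r s t → mono r s t ≈ u ^ r * v ^ s * w ^ t
  mono-power zero    zero    zero    = ≈-trans mono-000 (≈-sym (≈-trans (*-identityʳ (1# * 1#)) (*-identityʳ 1#)))
  mono-power zero    zero    (suc t) = ≈-trans (≈-sym (mono-* 0 0 1 0 0 t))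
    (≈-trans (*-congˡ {w} (mono-power 0 0 t)) (x∙yz≈y∙xz w (1# * 1#) (w ^ t)))
  mono-power zero    (suc s) t       = ≈-trans (≈-sym (mono-* 0 1 0 0 s t))
    (≈-trans (*-congˡ {v} (mono-power 0 s t)) (≈-trans (≈-sym (*-assoc v (1# * v ^ s) (w ^ t))) (*-congʳ {w ^ t} (x∙yz≈y∙xz v 1# (v ^ s)))))
  mono-power (suc r) s       t       = ≈-trans (≈-sym (mono-* 1 0 0 r s t))
    (≈-trans (*-congˡ {u} (mono-power r s t)) (≈-trans (≈-sym (*-assoc u (u ^ r * v ^ s) (w ^ t))) (*-congʳ {w ^ t} (≈-sym (*-assoc u (u ^ r) (v ^ s))))))

module CoefficientIdentities where

  open import Data.Nat as ℕ using (ℕ; zero; suc)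
  import Data.Nat.Properties as ℕ
  open import Data.Integer as ℤ using (ℤ; +_)
  import Data.Integer.Properties as ℤ
  open import Relation.Binary.PropositionalEquality using (_≡_; cong; cong₂; sym; trans; module ≡-Reasoning)
  open import Data.Nat.Tactic.RingSolver using () renaming (solve-∀ to ℕ-solve-∀)
  open import Data.Integer.Tactic.RingSolver using () renaming (solve-∀ to ℤ-solve-∀)
  open ≡-Reasoning

  tri : ℕ → ℕ
  tri zero    = 0
  tri (suc n) = n ℕ.+ tri n

  tri-+ : ∀ m n → tri (m ℕ.+ n) ≡ tri m ℕ.+ tri n ℕ.+ m ℕ.* n
  tri-+ zero    n = sym (ℕ.+-identityʳ (tri n))
  tri-+ (suc m) n = trans (cong (m ℕ.+ n ℕ.+_) (tri-+ m n)) (regroup m n (tri m) (tri n))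
    where
    regroup : ∀ m n a b → m ℕ.+ n ℕ.+ (a ℕ.+ b ℕ.+ m ℕ.* n) ≡ m ℕ.+ a ℕ.+ b ℕ.+ (n ℕ.+ m ℕ.* n)
    regroup = ℕ-solve-∀

  tri-+ℤ : ∀ m n → + tri m ℤ.+ + tri n ℤ.+ + m ℤ.* + n ≡ + tri (m ℕ.+ n)
  tri-+ℤ m n = begin
    + tri m ℤ.+ + tri n ℤ.+ + m ℤ.* + n   ≡⟨ cong₂ ℤ._+_ (sym (ℤ.pos-+ (tri m) (tri n))) (sym (ℤ.pos-* m n)) ⟩
    + (tri m ℕ.+ tri n) ℤ.+ + (m ℕ.* n)   ≡⟨ sym (ℤ.pos-+ (tri m ℕ.+ tri n) (m ℕ.* n)) ⟩
    + (tri m ℕ.+ tri n ℕ.+ m ℕ.* n)       ≡⟨ cong +_ (sym (tri-+ m n)) ⟩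
    + tri (m ℕ.+ n)                      ∎

  midℤ : ℤ → ℤ → ℤ
  midℤ a b = a ℤ.* b ℤ.+ b ℤ.- + 3 ℤ.* a ℤ.- + 1

  midℤ-+ : ∀ a₁ b₁ a₂ b₂ → midℤ a₁ b₁ ℤ.+ midℤ a₂ b₂ ℤ.+ (a₁ ℤ.* b₂ ℤ.+ b₁ ℤ.* a₂) ℤ.+ + 1 ≡ midℤ (a₁ ℤ.+ a₂) (b₁ ℤ.+ b₂)
  midℤ-+ = expanded
    where
    expanded : ∀ a₁ b₁ a₂ b₂ →
      (a₁ ℤ.* b₁ ℤ.+ b₁ ℤ.- + 3 ℤ.* a₁ ℤ.- + 1) ℤ.+ (a₂ ℤ.* b₂ ℤ.+ b₂ ℤ.- + 3 ℤ.* a₂ ℤ.- + 1) ℤ.+ (a₁ ℤ.* b₂ ℤ.+ b₁ ℤ.* a₂) ℤ.+ + 1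
        ≡ (a₁ ℤ.+ a₂) ℤ.* (b₁ ℤ.+ b₂) ℤ.+ (b₁ ℤ.+ b₂) ℤ.- + 3 ℤ.* (a₁ ℤ.+ a₂) ℤ.- + 1
    expanded = ℤ-solve-∀

  midℤ≡a[b∸4]+2 : ∀ A c → midℤ (+ A) (+ (3 ℕ.+ c)) ≡ + (suc A ℕ.* c ℕ.+ 2)
  midℤ≡a[b∸4]+2 A c = trans (expanded (+ A) (+ c)) (cong (ℤ._+ + 2) (sym (ℤ.pos-* (suc A) c)))
    where
    expanded : ∀ a c → a ℤ.* (+ 3 ℤ.+ c) ℤ.+ (+ 3 ℤ.+ c) ℤ.- + 3 ℤ.* a ℤ.- + 1 ≡ (+ 1 ℤ.+ a) ℤ.* c ℤ.+ + 2
    expanded = ℤ-solve-∀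

module SternBrocot where

  open import Data.Nat as ℕ using (ℕ; zero; suc; _+_; _*_; _∸_; _≤_; _<_; z≤n; s≤s)
  import Data.Nat.Properties as ℕ
  open import Data.Nat.Divisibility using (divides)
  open import Data.Nat.Coprimality using (Coprime)
  open import Data.Nat.Tactic.RingSolver using (solve-∀)
  open import Data.Product using (_×_; _,_; proj₁; proj₂)
  open import Relation.Binary using (tri<; tri≈; tri>)
  open import Relation.Binary.PropositionalEquality using (_≡_; refl; cong; sym; trans; subst; module ≡-Reasoning)

  -- SB p q r s: p/q < r/s are the endpoints of a node of the Stern–Brocot tree of [0, 1];
  -- the node itself is the mediant (p+r)/(q+s).
  data SB : ℕ → ℕ → ℕ → ℕ → Set where
    root  : SB 0 1 1 1
    left  : ∀ {p q r s} → SB p q r s → SB p q (p + r) (q + s)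
    right : ∀ {p q r s} → SB p q r s → SB (p + r) (q + s) r s

  record IsFareyPair (p q r s : ℕ) : Set where
    field
      det : q * r ≡ p * s + 1
      r≤s : r ≤ s
      1≤r : 1 ≤ r

  p<q : ∀ {p q r s} → IsFareyPair p q r s → p < q
  p<q {p} {q} {r} {s} farey = ℕ.≰⇒> λ q≤p → ℕ.1+n≰n (subst (_≤ p * s)
    (trans (IsFareyPair.det farey) (ℕ.+-comm (p * s) 1)) (ℕ.*-mono-≤ q≤p (IsFareyPair.r≤s farey)))

  isFareyPair : ∀ {p q r s} → SB p q r s → IsFareyPair p q r s
  isFareyPair root = record { det = refl ; r≤s = s≤s z≤n ; 1≤r = s≤s z≤n }
  isFareyPair (left {p} {q} {r} {s} node) = record
    { det = trans (ℕ.*-distribˡ-+ q p r) (trans (cong (q * p +_) det) (regroup p q s))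
    ; r≤s = ℕ.+-mono-≤ (ℕ.<⇒≤ (p<q farey)) r≤s
    ; 1≤r = ℕ.≤-trans 1≤r (ℕ.m≤n+m r p) }
    where
    farey = isFareyPair node
    open IsFareyPair farey
    regroup : ∀ p q s → q * p + (p * s + 1) ≡ p * (q + s) + 1
    regroup = solve-∀
  isFareyPair (right {p} {q} {r} {s} node) = record
    { det = trans (ℕ.*-distribʳ-+ r q s) (trans (cong (_+ s * r) det) (regroup p r s))
    ; r≤s = r≤s
    ; 1≤r = 1≤r }
    where
    open IsFareyPair (isFareyPair node)
    regroup : ∀ p r s → p * s + 1 + s * r ≡ (p + r) * s + 1
    regroup = solve-∀

  record Mediant (a b : ℕ) : Set where
    field
      {p q r s} : ℕ
      node : SB p q r s
      numerator : p + r ≡ a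
      denominator : q + s ≡ b

  private
    -- Cramer's rule for the unimodular matrix (p r; q s).
    cramer : ∀ {a b p q r s X Y} → q * r ≡ p * s + 1 → r * b ≡ s * a + X → a * q ≡ b * p + Y →
             a ≡ p * X + r * Y × b ≡ q * X + s * Y
    cramer {a} {b} {p} {q} {r} {s} {X} {Y} det e₁ e₂ =
        ℕ.+-cancelˡ-≡ (p * s * a) _ _ (begin
          p * s * a + a                ≡⟨ unfold p s a ⟩
          (p * s + 1) * a              ≡⟨ cong (_* a) (sym det) ⟩
          (q * r) * a                  ≡⟨ reorder₁ q r a ⟩
          r * (a * q)                  ≡⟨ cong (r *_) e₂ ⟩
          r * (b * p + Y)              ≡⟨ reorder₂ r b p Y ⟩
          p * (r * b) + r * Y          ≡⟨ cong (λ z → p * z + r * Y) e₁ ⟩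
          p * (s * a + X) + r * Y      ≡⟨ reorder₃ a p s X r Y ⟩
          p * s * a + (p * X + r * Y)  ∎)
      , ℕ.+-cancelˡ-≡ (p * s * b) _ _ (begin
          p * s * b + b                ≡⟨ unfold p s b ⟩
          (p * s + 1) * b              ≡⟨ cong (_* b) (sym det) ⟩
          (q * r) * b                  ≡⟨ ℕ.*-assoc q r b ⟩
          q * (r * b)                  ≡⟨ cong (q *_) e₁ ⟩
          q * (s * a + X)              ≡⟨ reorder₄ q s a X ⟩
          s * (a * q) + q * X          ≡⟨ cong (λ z → s * z + q * X) e₂ ⟩
          s * (b * p + Y) + q * X      ≡⟨ reorder₅ s b p Y q X ⟩
          p * s * b + (q * X + s * Y)  ∎)
      where
      open ≡-Reasoning
      unfold : ∀ p s a → p * s * a + a ≡ (p * s + 1) * a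
      unfold = solve-∀
      reorder₁ : ∀ q r a → (q * r) * a ≡ r * (a * q)
      reorder₁ = solve-∀
      reorder₂ : ∀ r b p Y → r * (b * p + Y) ≡ p * (r * b) + r * Y
      reorder₂ = solve-∀
      reorder₃ : ∀ a p s X r Y → p * (s * a + X) + r * Y ≡ p * s * a + (p * X + r * Y)
      reorder₃ = solve-∀
      reorder₄ : ∀ q s a X → q * (s * a + X) ≡ s * (a * q) + q * X
      reorder₄ = solve-∀
      reorder₅ : ∀ s b p Y q X → s * (b * p + Y) + q * X ≡ p * s * b + (q * X + s * Y)
      reorder₅ = solve-∀

  private
    right-gap : ∀ {a b p q r s X Y} → X ≤ Y → r * b ≡ s * a + X → a * q ≡ b * p + Y →
                a * (q + s) ≡ b * (p + r) + (Y ∸ X)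
    right-gap {a} {b} {p} {q} {r} {s} {X} {Y} X≤Y e₁ e₂ = begin
      a * (q + s)                      ≡⟨ ℕ.*-distribˡ-+ a q s ⟩
      a * q + a * s                    ≡⟨ cong (_+ a * s) e₂ ⟩
      b * p + Y + a * s                ≡⟨ cong (λ z → b * p + z + a * s) (sym (ℕ.m+[n∸m]≡n X≤Y)) ⟩
      b * p + (X + (Y ∸ X)) + a * s    ≡⟨ reorder₁ a b p s X (Y ∸ X) ⟩
      b * p + (s * a + X) + (Y ∸ X)    ≡⟨ cong (λ z → b * p + z + (Y ∸ X)) (sym e₁) ⟩
      b * p + r * b + (Y ∸ X)          ≡⟨ reorder₂ b p r (Y ∸ X) ⟩
      b * (p + r) + (Y ∸ X)            ∎
      where
      open ≡-Reasoning
      reorder₁ : ∀ a b p s X Z → b * p + (X + Z) + a * s ≡ b * p + (s * a + X) + Z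
      reorder₁ = solve-∀
      reorder₂ : ∀ b p r Z → b * p + r * b + Z ≡ b * (p + r) + Z
      reorder₂ = solve-∀

    left-gap : ∀ {a b p q r s X Y} → Y ≤ X → r * b ≡ s * a + X → a * q ≡ b * p + Y →
               (p + r) * b ≡ (q + s) * a + (X ∸ Y)
    left-gap {a} {b} {p} {q} {r} {s} {X} {Y} Y≤X e₁ e₂ = begin
      (p + r) * b                      ≡⟨ ℕ.*-distribʳ-+ b p r ⟩
      p * b + r * b                    ≡⟨ cong (p * b +_) e₁ ⟩
      p * b + (s * a + X)              ≡⟨ cong (λ z → p * b + (s * a + z)) (sym (ℕ.m+[n∸m]≡n Y≤X)) ⟩
      p * b + (s * a + (Y + (X ∸ Y)))  ≡⟨ reorder₁ a b p s Y (X ∸ Y) ⟩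
      b * p + Y + s * a + (X ∸ Y)      ≡⟨ cong (λ z → z + s * a + (X ∸ Y)) (sym e₂) ⟩
      a * q + s * a + (X ∸ Y)          ≡⟨ reorder₂ a q s (X ∸ Y) ⟩
      (q + s) * a + (X ∸ Y)            ∎
      where
      open ≡-Reasoning
      reorder₁ : ∀ a b p s Y Z → p * b + (s * a + (Y + Z)) ≡ b * p + Y + s * a + Z
      reorder₁ = solve-∀
      reorder₂ : ∀ a q s Z → a * q + s * a + Z ≡ (q + s) * a + Z
      reorder₂ = solve-∀

    equal-gaps : ∀ {a b p q r s X} → Coprime a b → SB p q r s → r * b ≡ s * a + X → a * q ≡ b * p + X → Mediant a b
    equal-gaps {a} {b} {p} {q} {r} {s} {X} coprime node e₁ e₂ = record { node = node ; numerator = sym a≡ ; denominator = sym b≡ }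
      where
      det = IsFareyPair.det (isFareyPair node)
      a≡X : a ≡ (p + r) * X
      a≡X = trans (proj₁ (cramer det e₁ e₂)) (sym (ℕ.*-distribʳ-+ X p r))
      b≡X : b ≡ (q + s) * X
      b≡X = trans (proj₂ (cramer det e₁ e₂)) (sym (ℕ.*-distribʳ-+ X q s))
      X≡1 : X ≡ 1
      X≡1 = coprime (divides (p + r) a≡X , divides (q + s) b≡X)
      a≡ : a ≡ p + r
      a≡ = trans a≡X (trans (cong ((p + r) *_) X≡1) (ℕ.*-identityʳ (p + r)))
      b≡ : b ≡ q + s
      b≡ = trans b≡X (trans (cong ((q + s) *_) X≡1) (ℕ.*-identityʳ (q + s)))

    fuel-decreases : ∀ {X Y n} → 1 ≤ X → X + Y ≤ suc n → Y ≤ n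
    fuel-decreases {X} {Y} 1≤X X+Y≤1+n = ℕ.≤-pred (ℕ.≤-trans (ℕ.+-monoˡ-≤ Y 1≤X) X+Y≤1+n)

    -- X = rb − sa and Y = aq − bp measure how far a/b lies inside the node (p/q, r/s): descending
    -- towards a/b lowers X + Y, and a/b is the node when X = Y, where coprimality forces X = 1.
    descend : ∀ fuel {a b} → Coprime a b → ∀ {p q r s} → SB p q r s → ∀ X Y → 1 ≤ X → 1 ≤ Y → X + Y ≤ fuel →
              r * b ≡ s * a + X → a * q ≡ b * p + Y → Mediant a b
    descend zero       coprime node (suc X) Y 1≤X 1≤Y () e₁ e₂
    descend (suc fuel) {a} {b} coprime {p} {q} {r} {s} node X Y 1≤X 1≤Y X+Y≤fuel e₁ e₂ with ℕ.<-cmp X Y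
    ... | tri≈ _ refl _ = equal-gaps {a} {b} coprime node e₁ e₂
    ... | tri< X<Y _ _  = descend fuel coprime (right node) X (Y ∸ X) 1≤X (ℕ.m<n⇒0<n∸m X<Y)
          (subst (_≤ fuel) (sym (ℕ.m+[n∸m]≡n (ℕ.<⇒≤ X<Y))) (fuel-decreases 1≤X X+Y≤fuel)) e₁ (right-gap {a} {b} {p} {q} {r} {s} (ℕ.<⇒≤ X<Y) e₁ e₂)
    ... | tri> _ _ Y<X  = descend fuel coprime (left node) (X ∸ Y) Y (ℕ.m<n⇒0<n∸m Y<X) 1≤Y
          (subst (_≤ fuel) (sym (ℕ.m∸n+n≡m (ℕ.<⇒≤ Y<X))) (fuel-decreases 1≤Y (subst (_≤ suc fuel) (ℕ.+-comm X Y) X+Y≤fuel)))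
          (left-gap {a} {b} {p} {q} {r} {s} (ℕ.<⇒≤ Y<X) e₁ e₂) e₂

  coprime⇒mediant : ∀ {a b} → Coprime a b → 1 ≤ a → a < b → Mediant a b
  coprime⇒mediant {a} {b} coprime 1≤a a<b = descend (b ∸ a + a) coprime root (b ∸ a) a (ℕ.m<n⇒0<n∸m a<b) 1≤a ℕ.≤-refl
    (trans (ℕ.*-identityˡ b) (trans (sym (ℕ.m+[n∸m]≡n (ℕ.<⇒≤ a<b))) (cong (_+ (b ∸ a)) (sym (ℕ.*-identityˡ a)))))
    (trans (ℕ.*-identityʳ a) (sym (cong (_+ a) (ℕ.*-zeroʳ b))))

module Expansion (R : CommutativeRing 0ℓ 0ℓ) where

  open CommutativeRing R

  module Jet
    (ℤ-hom : CommutativeRing.rawRing ℤ.+-*-commutativeRing -Raw-AlmostCommutative⟶ fromCommutativeRing R)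
    (u v w : Carrier) (w³≈0 : w * (w * w) ≈ 0#) (S-regular : ∀ X → X * (u + v) ≈ 0# → X ≈ 0#)
    where

    open import Data.Nat as ℕ using (ℕ; zero; suc; _≤_; _<_; z≤n; s≤s)
    import Data.Nat.Properties as ℕ
    open import Data.Nat.Coprimality using (Coprime)
    open import Data.Nat.Tactic.RingSolver using () renaming (solve-∀ to ℕ-solve-∀)
    open import Data.Integer as ℤ using (ℤ; +_)
    open import Data.Integer.Tactic.RingSolver using () renaming (solve-∀ to ℤ-solve-∀)
    open import Data.Maybe using (Maybe; just; nothing)
    open import Data.Product using (∃-syntax; _,_; proj₁; proj₂)
    open import Data.Sum using (_⊎_; inj₁; inj₂)
    open import Relation.Nullary using (yes; no)
    open import Relation.Binary.PropositionalEquality as ≡ using (_≡_)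
    open import Relation.Binary.Reasoning.Setoid setoid
    import Algebra.Solver.Ring
    open import Algebra.Properties.Group +-group using (∙-cancelʳ)
    open import Algebra.Properties.Semiring.Exp semiring using (_^_; ^-homo-*; ^-congʳ)
    open import Algebra.Properties.CommutativeSemigroup *-commutativeSemigroup
      using (interchange; x∙yz≈y∙xz; x∙yz≈yx∙z; x∙yz≈xz∙y; xy∙z≈xz∙y)
    open CoefficientIdentities
    open SternBrocot

    open _-Raw-AlmostCommutative⟶_ ℤ-hom renaming (⟦_⟧ to ι)

    private
      ι-equal? : ∀ a b → Maybe (ι a ≈ ι b)
      ι-equal? a b with a ℤ.≟ b
      ... | yes ≡.refl = just refl
      ... | no _       = nothing

    module Solver = Algebra.Solver.Ring (CommutativeRing.rawRing ℤ.+-*-commutativeRing) (fromCommutativeRing R) ℤ-hom ι-equal?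
    open Solver using (solve; con; _:+_; _:*_; :-_; _:-_; _:^_; _:=_)

    S : Carrier
    S = u + v

    S^-cancel : ∀ n X → X * S ^ n ≈ 0# → X ≈ 0#
    S^-cancel zero    X X≈0     = trans (sym (*-identityʳ X)) X≈0
    S^-cancel (suc n) X XSⁿ⁺¹≈0 = S-regular X (S^-cancel n (X * S) (trans (*-assoc X S (S ^ n)) XSⁿ⁺¹≈0))

    *S^-cancelʳ : ∀ n {A B} → A * S ^ n ≈ B * S ^ n → A ≈ B
    *S^-cancelʳ n {A} {B} ASⁿ≈BSⁿ = begin
      A               ≈⟨ split A B ⟩
      (A - B) + B     ≈⟨ +-congʳ (S^-cancel n (A - B) (begin
                           (A - B) * S ^ n          ≈⟨ distrib-minus A B (S ^ n) ⟩
                           A * S ^ n - B * S ^ n    ≈⟨ +-congʳ ASⁿ≈BSⁿ ⟩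
                           B * S ^ n - B * S ^ n    ≈⟨ -‿inverseʳ (B * S ^ n) ⟩
                           0#                       ∎)) ⟩
      0# + B          ≈⟨ +-identityˡ B ⟩
      B               ∎
      where
      distrib-minus : ∀ a b c → (a - b) * c ≈ a * c - b * c
      distrib-minus = solve 3 (λ a b c → (a :- b) :* c := a :* c :- b :* c) refl
      split : ∀ a b → a ≈ (a - b) + b
      split = solve 2 (λ a b → a := (a :- b) :+ b) refl

    divide-S⁴ : ∀ {m} n {X J} → m ≡ n ℕ.+ 4 → X * S ^ 4 ≈ S ^ m * J → X ≈ S ^ n * J
    divide-S⁴ {m} n {X} {J} m≡n+4 XS⁴≈ = *S^-cancelʳ 4 (begin
      X * S ^ 4              ≈⟨ XS⁴≈ ⟩
      S ^ m * J              ≈⟨ *-congʳ (trans (^-congʳ S m≡n+4) (^-homo-* S n 4)) ⟩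
      S ^ n * S ^ 4 * J      ≈⟨ xy∙z≈xz∙y _ _ _ ⟩
      S ^ n * J * S ^ 4      ∎)

    w^-vanishes : ∀ t → 3 ℕ.≤ t → w ^ t ≈ 0#
    w^-vanishes t 3≤t = begin
      w ^ t                    ≈⟨ ^-congʳ w (≡.sym (ℕ.m+[n∸m]≡n 3≤t)) ⟩
      w ^ (3 ℕ.+ (t ℕ.∸ 3))    ≈⟨ ^-homo-* w 3 (t ℕ.∸ 3) ⟩
      w ^ 3 * w ^ (t ℕ.∸ 3)    ≈⟨ *-congʳ (trans (*-congˡ (*-congˡ (*-identityʳ w))) w³≈0) ⟩
      0# * w ^ (t ℕ.∸ 3)       ≈⟨ zeroˡ _ ⟩
      0#                       ∎

    -- P_{a/b} ≡ S^(a+b-5) · jet L Q (mod w³); expansions are multiplied by S⁴ to avoid negative powers of S.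
    jet : Carrier → Carrier → Carrier
    jet L Q = S ^ 4 + w * (S ^ 2 * L) + (w * w) * Q

    jet-cong : ∀ {L L′ Q Q′} → L ≈ L′ → Q ≈ Q′ → jet L Q ≈ jet L′ Q′
    jet-cong L≈L′ Q≈Q′ = +-cong (+-congˡ (*-congˡ (*-congˡ L≈L′))) (*-congˡ Q≈Q′)

    +w³-absorb : ∀ M R → M + (w * (w * w)) * R ≈ M
    +w³-absorb M R = begin
      M + (w * (w * w)) * R ≈⟨ +-congˡ (*-congʳ w³≈0) ⟩
      M + 0# * R            ≈⟨ +-congˡ (zeroˡ R) ⟩
      M + 0#                ≈⟨ +-identityʳ M ⟩
      M                     ∎

    w²*jet : ∀ L Q → (w * w) * jet L Q ≈ (w * w) * S ^ 4
    w²*jet L Q = trans (expand S w L Q) (+w³-absorb _ _)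
      where
      expand : ∀ s w L Q → (w * w) * (s ^ 4 + w * (s ^ 2 * L) + (w * w) * Q) ≈
                           (w * w) * s ^ 4 + (w * (w * w)) * (s ^ 2 * L + w * Q)
      expand = solve 4 (λ s w L Q → (w :* w) :* (s :^ 4 :+ w :* (s :^ 2 :* L) :+ (w :* w) :* Q) :=
                                    (w :* w) :* s :^ 4 :+ (w :* (w :* w)) :* (s :^ 2 :* L :+ w :* Q)) refl

    jet-product : ∀ L₁ Q₁ L₂ Q₂ → jet L₁ Q₁ * jet L₂ Q₂ ≈
      S ^ 8 + w * (S ^ 6 * (L₁ + L₂)) + (w * w) * (S ^ 4 * (Q₁ + Q₂ + L₁ * L₂))
    jet-product L₁ Q₁ L₂ Q₂ = trans (expand S w L₁ Q₁ L₂ Q₂) (+w³-absorb _ _)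
      where
      expand : ∀ s w L₁ Q₁ L₂ Q₂ →
        (s ^ 4 + w * (s ^ 2 * L₁) + (w * w) * Q₁) * (s ^ 4 + w * (s ^ 2 * L₂) + (w * w) * Q₂) ≈
        (s ^ 8 + w * (s ^ 6 * (L₁ + L₂)) + (w * w) * (s ^ 4 * (Q₁ + Q₂ + L₁ * L₂)))
        + (w * (w * w)) * (s ^ 2 * L₁ * Q₂ + s ^ 2 * L₂ * Q₁ + w * (Q₁ * Q₂))
      expand = solve 6 (λ s w L₁ Q₁ L₂ Q₂ →
        (s :^ 4 :+ w :* (s :^ 2 :* L₁) :+ (w :* w) :* Q₁) :* (s :^ 4 :+ w :* (s :^ 2 :* L₂) :+ (w :* w) :* Q₂) :=
        (s :^ 8 :+ w :* (s :^ 6 :* (L₁ :+ L₂)) :+ (w :* w) :* (s :^ 4 :* (Q₁ :+ Q₂ :+ L₁ :* L₂)))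
        :+ (w :* (w :* w)) :* (s :^ 2 :* L₁ :* Q₂ :+ s :^ 2 :* L₂ :* Q₁ :+ w :* (Q₁ :* Q₂))) refl

    jet-balanced : ∀ {L₁ Q₁ L₂ Q₂ L Q} → L₁ + L₂ ≈ L + L → Q₁ + Q₂ + L₁ * L₂ ≈ Q + Q + L * L →
                   jet L₁ Q₁ * jet L₂ Q₂ ≈ jet L Q * jet L Q
    jet-balanced {L₁} {Q₁} {L₂} {Q₂} {L} {Q} ΣL ΣQ = begin
      jet L₁ Q₁ * jet L₂ Q₂                                                       ≈⟨ jet-product L₁ Q₁ L₂ Q₂ ⟩
      S ^ 8 + w * (S ^ 6 * (L₁ + L₂)) + (w * w) * (S ^ 4 * (Q₁ + Q₂ + L₁ * L₂))   ≈⟨ +-cong (+-congˡ (*-congˡ (*-congˡ ΣL))) (*-congˡ (*-congˡ ΣQ)) ⟩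
      S ^ 8 + w * (S ^ 6 * (L + L)) + (w * w) * (S ^ 4 * (Q + Q + L * L))         ≈⟨ sym (jet-product L Q L Q) ⟩
      jet L Q * jet L Q                                                           ∎

    jet-*-conjugate : ∀ L Q → jet L Q * jet (- L) (L * L - Q) ≈ S ^ 8
    jet-*-conjugate L Q = trans (expand S w L Q) (+w³-absorb _ _)
      where
      expand : ∀ s w L Q →
        (s ^ 4 + w * (s ^ 2 * L) + (w * w) * Q) * (s ^ 4 + w * (s ^ 2 * - L) + (w * w) * (L * L - Q)) ≈
        s ^ 8 + (w * (w * w)) * (s ^ 2 * L * (L * L - Q) - s ^ 2 * L * Q + w * (Q * (L * L - Q)))
      expand = solve 4 (λ s w L Q →
        (s :^ 4 :+ w :* (s :^ 2 :* L) :+ (w :* w) :* Q) :* (s :^ 4 :+ w :* (s :^ 2 :* :- L) :+ (w :* w) :* (L :* L :- Q)) :=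
        s :^ 8 :+ (w :* (w :* w)) :* (s :^ 2 :* L :* (L :* L :- Q) :- s :^ 2 :* L :* Q :+ w :* (Q :* (L :* L :- Q)))) refl

    *jet-cancelʳ : ∀ n L Q {A B} → A * (S ^ n * jet L Q) ≈ B * (S ^ n * jet L Q) → A ≈ B
    *jet-cancelʳ n L Q {A} {B} A≈B = *S^-cancelʳ (n ℕ.+ 8) (begin
      A * S ^ (n ℕ.+ 8)                  ≈⟨ *-congˡ unfold ⟩
      A * (S ^ n * (jet L Q * J′))       ≈⟨ reassoc A (S ^ n) (jet L Q) J′ ⟩
      (A * (S ^ n * jet L Q)) * J′       ≈⟨ *-congʳ A≈B ⟩
      (B * (S ^ n * jet L Q)) * J′       ≈⟨ sym (reassoc B (S ^ n) (jet L Q) J′) ⟩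
      B * (S ^ n * (jet L Q * J′))       ≈⟨ *-congˡ (sym unfold) ⟩
      B * S ^ (n ℕ.+ 8)                  ∎)
      where
      J′ : Carrier
      J′ = jet (- L) (L * L - Q)
      unfold : S ^ (n ℕ.+ 8) ≈ S ^ n * (jet L Q * J′)
      unfold = trans (^-homo-* S n 8) (*-congˡ (sym (jet-*-conjugate L Q)))
      reassoc : ∀ a p x y → a * (p * (x * y)) ≈ (a * (p * x)) * y
      reassoc = solve 4 (λ a p x y → a :* (p :* (x :* y)) := (a :* (p :* x)) :* y) refl

    jet-left-boundary : ∀ {L₁ Q₁ L Q} → L₁ ≈ L + L → Q₁ ≈ u * v + (Q + Q + L * L) →
                        S ^ 4 * jet L₁ Q₁ ≈ u * v * (w * w) * S ^ 4 + jet L Q * jet L Q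
    jet-left-boundary {L₁} {Q₁} {L} {Q} L₁≈ Q₁≈ = begin
      S ^ 4 * jet L₁ Q₁                                    ≈⟨ *-congˡ (jet-cong L₁≈ Q₁≈) ⟩
      S ^ 4 * jet (L + L) (u * v + (Q + Q + L * L))        ≈⟨ expand S w u v L Q ⟩
      u * v * (w * w) * S ^ 4
        + (S ^ 8 + w * (S ^ 6 * (L + L)) + (w * w) * (S ^ 4 * (Q + Q + L * L)))  ≈⟨ +-congˡ (sym (jet-product L Q L Q)) ⟩
      u * v * (w * w) * S ^ 4 + jet L Q * jet L Q          ∎
      where
      expand : ∀ s w u v L Q →
        s ^ 4 * (s ^ 4 + w * (s ^ 2 * (L + L)) + (w * w) * (u * v + (Q + Q + L * L))) ≈
        u * v * (w * w) * s ^ 4 + (s ^ 8 + w * (s ^ 6 * (L + L)) + (w * w) * (s ^ 4 * (Q + Q + L * L)))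
      expand = solve 6 (λ s w u v L Q →
        s :^ 4 :* (s :^ 4 :+ w :* (s :^ 2 :* (L :+ L)) :+ (w :* w) :* (u :* v :+ (Q :+ Q :+ L :* L))) :=
        u :* v :* (w :* w) :* s :^ 4 :+ (s :^ 8 :+ w :* (s :^ 6 :* (L :+ L)) :+ (w :* w) :* (s :^ 4 :* (Q :+ Q :+ L :* L)))) refl

    jet-right-boundary : ∀ {L₁ Q₁ L Q Lᵣ Qᵣ} → L₁ ≈ L + L + v → Q₁ ≈ Q + Q + L * L + v * (Lᵣ + Lᵣ) →
                         S ^ 6 * jet L₁ Q₁ ≈ S ^ 2 * (jet L Q * jet L Q) + v * w * (jet Lᵣ Qᵣ * jet Lᵣ Qᵣ)
    jet-right-boundary {L₁} {Q₁} {L} {Q} {Lᵣ} {Qᵣ} L₁≈ Q₁≈ = begin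
      S ^ 6 * jet L₁ Q₁                                                  ≈⟨ *-congˡ (jet-cong L₁≈ Q₁≈) ⟩
      S ^ 6 * jet (L + L + v) (Q + Q + L * L + v * (Lᵣ + Lᵣ))            ≈⟨ sym (+w³-absorb _ _) ⟩
      S ^ 6 * jet (L + L + v) (Q + Q + L * L + v * (Lᵣ + Lᵣ))
        + (w * (w * w)) * (v * (S ^ 4 * (Qᵣ + Qᵣ + Lᵣ * Lᵣ)))            ≈⟨ expand S w v L Q Lᵣ Qᵣ ⟩
      S ^ 2 * (S ^ 8 + w * (S ^ 6 * (L + L)) + (w * w) * (S ^ 4 * (Q + Q + L * L)))
        + v * w * (S ^ 8 + w * (S ^ 6 * (Lᵣ + Lᵣ)) + (w * w) * (S ^ 4 * (Qᵣ + Qᵣ + Lᵣ * Lᵣ)))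
                                                                         ≈⟨ +-cong (*-congˡ (sym (jet-product L Q L Q)))
                                                                                   (*-congˡ (sym (jet-product Lᵣ Qᵣ Lᵣ Qᵣ))) ⟩
      S ^ 2 * (jet L Q * jet L Q) + v * w * (jet Lᵣ Qᵣ * jet Lᵣ Qᵣ)      ∎
      where
      expand : ∀ s w v L Q Lᵣ Qᵣ →
        s ^ 6 * (s ^ 4 + w * (s ^ 2 * (L + L + v)) + (w * w) * (Q + Q + L * L + v * (Lᵣ + Lᵣ)))
          + (w * (w * w)) * (v * (s ^ 4 * (Qᵣ + Qᵣ + Lᵣ * Lᵣ))) ≈
        s ^ 2 * (s ^ 8 + w * (s ^ 6 * (L + L)) + (w * w) * (s ^ 4 * (Q + Q + L * L)))
          + v * w * (s ^ 8 + w * (s ^ 6 * (Lᵣ + Lᵣ)) + (w * w) * (s ^ 4 * (Qᵣ + Qᵣ + Lᵣ * Lᵣ)))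
      expand = solve 7 (λ s w v L Q Lᵣ Qᵣ →
        s :^ 6 :* (s :^ 4 :+ w :* (s :^ 2 :* (L :+ L :+ v)) :+ (w :* w) :* (Q :+ Q :+ L :* L :+ v :* (Lᵣ :+ Lᵣ)))
          :+ (w :* (w :* w)) :* (v :* (s :^ 4 :* (Qᵣ :+ Qᵣ :+ Lᵣ :* Lᵣ))) :=
        s :^ 2 :* (s :^ 8 :+ w :* (s :^ 6 :* (L :+ L)) :+ (w :* w) :* (s :^ 4 :* (Q :+ Q :+ L :* L)))
          :+ v :* w :* (s :^ 8 :+ w :* (s :^ 6 :* (Lᵣ :+ Lᵣ)) :+ (w :* w) :* (s :^ 4 :* (Qᵣ :+ Qᵣ :+ Lᵣ :* Lᵣ)))) refl

    leading-term : ∀ {P n L Q} → P * S ^ 4 ≈ S ^ n * jet L Q → (w * w) * P ≈ (w * w) * S ^ n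
    leading-term {P} {n} {L} {Q} expansion = *S^-cancelʳ 4 (begin
      (w * w) * P * S ^ 4          ≈⟨ *-assoc _ _ _ ⟩
      (w * w) * (P * S ^ 4)        ≈⟨ *-congˡ expansion ⟩
      (w * w) * (S ^ n * jet L Q)  ≈⟨ x∙yz≈y∙xz _ _ _ ⟩
      S ^ n * ((w * w) * jet L Q)  ≈⟨ *-congˡ (w²*jet L Q) ⟩
      S ^ n * ((w * w) * S ^ 4)    ≈⟨ x∙yz≈yx∙z _ _ _ ⟩
      (w * w) * S ^ n * S ^ 4      ∎)

    expansion-balanced : ∀ {P₁ P₂ P n₁ n₂ n L₁ Q₁ L₂ Q₂ L Q} →
      n₁ ℕ.+ n₂ ≡ n ℕ.+ n → L₁ + L₂ ≈ L + L → Q₁ + Q₂ + L₁ * L₂ ≈ Q + Q + L * L →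
      P₁ * P₂ ≈ P * P → P₂ * S ^ 4 ≈ S ^ n₂ * jet L₂ Q₂ → P * S ^ 4 ≈ S ^ n * jet L Q →
      P₁ * S ^ 4 ≈ S ^ n₁ * jet L₁ Q₁
    expansion-balanced {P₁} {P₂} {P} {n₁} {n₂} {n} {L₁} {Q₁} {L₂} {Q₂} {L} {Q} Σn ΣL ΣQ P₁P₂≈P² expansion₂ expansion =
      *jet-cancelʳ n₂ L₂ Q₂ (begin
        (P₁ * S ^ 4) * (S ^ n₂ * jet L₂ Q₂)                 ≈⟨ *-congˡ (sym expansion₂) ⟩
        (P₁ * S ^ 4) * (P₂ * S ^ 4)                         ≈⟨ interchange _ _ _ _ ⟩
        (P₁ * P₂) * (S ^ 4 * S ^ 4)                         ≈⟨ *-congʳ P₁P₂≈P² ⟩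
        (P * P) * (S ^ 4 * S ^ 4)                           ≈⟨ interchange _ _ _ _ ⟩
        (P * S ^ 4) * (P * S ^ 4)                           ≈⟨ *-cong expansion expansion ⟩
        (S ^ n * jet L Q) * (S ^ n * jet L Q)               ≈⟨ interchange _ _ _ _ ⟩
        (S ^ n * S ^ n) * (jet L Q * jet L Q)               ≈⟨ *-cong (sym (^-homo-* S n n)) (sym (jet-balanced ΣL ΣQ)) ⟩
        S ^ (n ℕ.+ n) * (jet L₁ Q₁ * jet L₂ Q₂)             ≈⟨ *-congʳ (trans (^-congʳ S (≡.sym Σn)) (^-homo-* S n₁ n₂)) ⟩
        (S ^ n₁ * S ^ n₂) * (jet L₁ Q₁ * jet L₂ Q₂)         ≈⟨ interchange _ _ _ _ ⟩
        (S ^ n₁ * jet L₁ Q₁) * (S ^ n₂ * jet L₂ Q₂)         ∎)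

    expansion-left-boundary : ∀ {P₁ P₀ P n₁ n₀ n L₁ Q₁ L Q} →
      n₁ ℕ.+ 1 ≡ n ℕ.+ n → n₀ ℕ.+ 2 ≡ n → L₁ ≈ L + L → Q₁ ≈ u * v + (Q + Q + L * L) →
      P₁ * S ≈ u * v * (w * w) * (P₀ * P₀) + P * P →
      (w * w) * P₀ ≈ (w * w) * S ^ n₀ → P * S ^ 4 ≈ S ^ n * jet L Q →
      P₁ * S ^ 4 ≈ S ^ n₁ * jet L₁ Q₁
    expansion-left-boundary {P₁} {P₀} {P} {n₁} {n₀} {n} {L₁} {Q₁} {L} {Q} Σn n≡ L₁≈ Q₁≈ recurrence leading expansion =
      *S^-cancelʳ 5 (begin
        P₁ * S ^ 4 * S ^ 5                                                 ≈⟨ regroup₁ P₁ S ⟩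
        P₁ * S * S ^ 8                                                     ≈⟨ *-congʳ recurrence ⟩
        (u * v * (w * w) * (P₀ * P₀) + P * P) * S ^ 8                      ≈⟨ regroup₂ u v w P₀ P S ⟩
        u * v * ((w * w) * P₀ * P₀) * S ^ 8 + (P * S ^ 4) * (P * S ^ 4)    ≈⟨ +-cong (*-congʳ (*-congˡ leading²)) (*-cong expansion expansion) ⟩
        u * v * ((w * w) * T * T) * S ^ 8 + (S ^ n * J) * (S ^ n * J)      ≈⟨ +-congˡ (*-cong (*-congʳ Sⁿ≈) (*-congʳ Sⁿ≈)) ⟩
        u * v * ((w * w) * T * T) * S ^ 8 + (T * S ^ 2 * J) * (T * S ^ 2 * J)  ≈⟨ regroup₃ u v w T S J ⟩
        T * S ^ 2 * (T * S ^ 2) * (u * v * (w * w) * S ^ 4 + J * J)        ≈⟨ *-cong (sym (*-cong Sⁿ≈ Sⁿ≈)) (sym (jet-left-boundary L₁≈ Q₁≈)) ⟩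
        S ^ n * S ^ n * (S ^ 4 * jet L₁ Q₁)                                ≈⟨ *-congʳ (trans (sym (^-homo-* S n n)) (trans (^-congʳ S (≡.sym Σn)) (^-homo-* S n₁ 1))) ⟩
        S ^ n₁ * S ^ 1 * (S ^ 4 * jet L₁ Q₁)                               ≈⟨ regroup₄ (S ^ n₁) S (jet L₁ Q₁) ⟩
        S ^ n₁ * jet L₁ Q₁ * S ^ 5                                         ∎)
      where
      T J : Carrier
      T = S ^ n₀
      J = jet L Q
      Sⁿ≈ : S ^ n ≈ T * S ^ 2
      Sⁿ≈ = trans (^-congʳ S (≡.sym n≡)) (^-homo-* S n₀ 2)
      leading² : (w * w) * P₀ * P₀ ≈ (w * w) * T * T
      leading² = begin
        (w * w) * P₀ * P₀   ≈⟨ *-congʳ leading ⟩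
        (w * w) * T * P₀    ≈⟨ xy∙z≈xz∙y _ _ _ ⟩
        (w * w) * P₀ * T    ≈⟨ *-congʳ leading ⟩
        (w * w) * T * T     ∎
      regroup₁ : ∀ p s → p * s ^ 4 * s ^ 5 ≈ p * s * s ^ 8
      regroup₁ = solve 2 (λ p s → p :* s :^ 4 :* s :^ 5 := p :* s :* s :^ 8) refl
      regroup₂ : ∀ u v w p₀ p s → (u * v * (w * w) * (p₀ * p₀) + p * p) * s ^ 8 ≈
                                   u * v * ((w * w) * p₀ * p₀) * s ^ 8 + (p * s ^ 4) * (p * s ^ 4)
      regroup₂ = solve 6 (λ u v w p₀ p s → (u :* v :* (w :* w) :* (p₀ :* p₀) :+ p :* p) :* s :^ 8 :=
                                            u :* v :* ((w :* w) :* p₀ :* p₀) :* s :^ 8 :+ (p :* s :^ 4) :* (p :* s :^ 4)) refl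
      regroup₃ : ∀ u v w t s j → u * v * ((w * w) * t * t) * s ^ 8 + (t * s ^ 2 * j) * (t * s ^ 2 * j) ≈
                                  t * s ^ 2 * (t * s ^ 2) * (u * v * (w * w) * s ^ 4 + j * j)
      regroup₃ = solve 6 (λ u v w t s j → u :* v :* ((w :* w) :* t :* t) :* s :^ 8 :+ (t :* s :^ 2 :* j) :* (t :* s :^ 2 :* j) :=
                                           t :* s :^ 2 :* (t :* s :^ 2) :* (u :* v :* (w :* w) :* s :^ 4 :+ j :* j)) refl
      regroup₄ : ∀ a s j → a * s ^ 1 * (s ^ 4 * j) ≈ a * j * s ^ 5
      regroup₄ = solve 3 (λ a s j → a :* s :^ 1 :* (s :^ 4 :* j) := a :* j :* s :^ 5) refl

    expansion-right-boundary : ∀ {P₁ Pᵣ P n₁ nᵣ n L₁ Q₁ Lᵣ Qᵣ L Q} →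
      n ≡ suc nᵣ → n₁ ≡ n ℕ.+ n → L₁ ≈ L + L + v → Q₁ ≈ Q + Q + L * L + v * (Lᵣ + Lᵣ) →
      P₁ ≈ P * P + v * w * (Pᵣ * Pᵣ) →
      Pᵣ * S ^ 4 ≈ S ^ nᵣ * jet Lᵣ Qᵣ → P * S ^ 4 ≈ S ^ n * jet L Q →
      P₁ * S ^ 4 ≈ S ^ n₁ * jet L₁ Q₁
    expansion-right-boundary {P₁} {Pᵣ} {P} {n₁} {nᵣ} {n} {L₁} {Q₁} {Lᵣ} {Qᵣ} {L} {Q} n≡ n₁≡ L₁≈ Q₁≈ recurrence expansionᵣ expansion =
      *S^-cancelʳ 4 (begin
        P₁ * S ^ 4 * S ^ 4                                                 ≈⟨ *-congʳ (*-congʳ recurrence) ⟩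
        (P * P + v * w * (Pᵣ * Pᵣ)) * S ^ 4 * S ^ 4                        ≈⟨ regroup₁ P v w Pᵣ S ⟩
        (P * S ^ 4) * (P * S ^ 4) + v * w * ((Pᵣ * S ^ 4) * (Pᵣ * S ^ 4))  ≈⟨ +-cong (*-cong expansion expansion) (*-congˡ (*-cong expansionᵣ expansionᵣ)) ⟩
        (S ^ n * J) * (S ^ n * J) + v * w * ((T * Jᵣ) * (T * Jᵣ))          ≈⟨ +-congʳ (*-cong (*-congʳ Sⁿ≈) (*-congʳ Sⁿ≈)) ⟩
        (T * S * J) * (T * S * J) + v * w * ((T * Jᵣ) * (T * Jᵣ))          ≈⟨ regroup₂ T S J v w Jᵣ ⟩
        T * T * (S ^ 2 * (J * J) + v * w * (Jᵣ * Jᵣ))                      ≈⟨ *-congˡ (sym (jet-right-boundary L₁≈ Q₁≈)) ⟩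
        T * T * (S ^ 6 * jet L₁ Q₁)                                        ≈⟨ regroup₃ T S (jet L₁ Q₁) ⟩
        T * S * (T * S) * (S ^ 4 * jet L₁ Q₁)                              ≈⟨ *-congʳ (sym (*-cong Sⁿ≈ Sⁿ≈)) ⟩
        S ^ n * S ^ n * (S ^ 4 * jet L₁ Q₁)                                ≈⟨ *-congʳ (trans (sym (^-homo-* S n n)) (^-congʳ S (≡.sym n₁≡))) ⟩
        S ^ n₁ * (S ^ 4 * jet L₁ Q₁)                                       ≈⟨ x∙yz≈xz∙y _ _ _ ⟩
        S ^ n₁ * jet L₁ Q₁ * S ^ 4                                         ∎)
      where
      T J Jᵣ : Carrier
      T = S ^ nᵣ
      J = jet L Q
      Jᵣ = jet Lᵣ Qᵣ
      Sⁿ≈ : S ^ n ≈ T * S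
      Sⁿ≈ = trans (^-congʳ S n≡) (*-comm S T)
      regroup₁ : ∀ p v w pᵣ s → (p * p + v * w * (pᵣ * pᵣ)) * s ^ 4 * s ^ 4 ≈
                                (p * s ^ 4) * (p * s ^ 4) + v * w * ((pᵣ * s ^ 4) * (pᵣ * s ^ 4))
      regroup₁ = solve 5 (λ p v w pᵣ s → (p :* p :+ v :* w :* (pᵣ :* pᵣ)) :* s :^ 4 :* s :^ 4 :=
                                          (p :* s :^ 4) :* (p :* s :^ 4) :+ v :* w :* ((pᵣ :* s :^ 4) :* (pᵣ :* s :^ 4))) refl
      regroup₂ : ∀ t s j v w jᵣ → (t * s * j) * (t * s * j) + v * w * ((t * jᵣ) * (t * jᵣ)) ≈
                                  t * t * (s ^ 2 * (j * j) + v * w * (jᵣ * jᵣ))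
      regroup₂ = solve 6 (λ t s j v w jᵣ → (t :* s :* j) :* (t :* s :* j) :+ v :* w :* ((t :* jᵣ) :* (t :* jᵣ)) :=
                                            t :* t :* (s :^ 2 :* (j :* j) :+ v :* w :* (jᵣ :* jᵣ))) refl
      regroup₃ : ∀ t s j → t * t * (s ^ 6 * j) ≈ t * s * (t * s) * (s ^ 4 * j)
      regroup₃ = solve 3 (λ t s j → t :* t :* (s :^ 6 :* j) := t :* s :* (t :* s) :* (s :^ 4 :* j)) refl

    linear : ℤ → ℤ → Carrier
    linear x y = ι x * v + ι y * u

    quadratic : ℤ → ℤ → ℤ → Carrier
    quadratic α μ β = ι α * (v * v) + ι μ * (u * v) + ι β * (u * u)

    linear-+ : ∀ x y x′ y′ → linear x y + linear x′ y′ ≈ linear (x ℤ.+ x′) (y ℤ.+ y′)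
    linear-+ x y x′ y′ = trans (expand (ι x) (ι y) (ι x′) (ι y′) u v)
      (sym (+-cong (*-congʳ (+-homo x x′)) (*-congʳ (+-homo y y′))))
      where
      expand : ∀ a b c d u v → a * v + b * u + (c * v + d * u) ≈ (a + c) * v + (b + d) * u
      expand = solve 6 (λ a b c d u v → a :* v :+ b :* u :+ (c :* v :+ d :* u) := (a :+ c) :* v :+ (b :+ d) :* u) refl

    quadratic-+ : ∀ α μ β α′ μ′ β′ → quadratic α μ β + quadratic α′ μ′ β′ ≈ quadratic (α ℤ.+ α′) (μ ℤ.+ μ′) (β ℤ.+ β′)
    quadratic-+ α μ β α′ μ′ β′ = trans (expand (ι α) (ι μ) (ι β) (ι α′) (ι μ′) (ι β′) (v * v) (u * v) (u * u))
      (sym (+-cong (+-cong (*-congʳ (+-homo α α′)) (*-congʳ (+-homo μ μ′))) (*-congʳ (+-homo β β′))))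
      where
      expand : ∀ a m b a′ m′ b′ X Y Z → a * X + m * Y + b * Z + (a′ * X + m′ * Y + b′ * Z) ≈ (a + a′) * X + (m + m′) * Y + (b + b′) * Z
      expand = solve 9 (λ a m b a′ m′ b′ X Y Z → a :* X :+ m :* Y :+ b :* Z :+ (a′ :* X :+ m′ :* Y :+ b′ :* Z) :=
                                                (a :+ a′) :* X :+ (m :+ m′) :* Y :+ (b :+ b′) :* Z) refl

    linear-* : ∀ x y x′ y′ → linear x y * linear x′ y′ ≈ quadratic (x ℤ.* x′) (x ℤ.* y′ ℤ.+ y ℤ.* x′) (y ℤ.* y′)
    linear-* x y x′ y′ = trans (expand (ι x) (ι y) (ι x′) (ι y′) u v)
      (sym (+-cong (+-cong (*-congʳ (*-homo x x′)) (*-congʳ (trans (+-homo _ _) (+-cong (*-homo x y′) (*-homo y x′)))))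
                   (*-congʳ (*-homo y y′))))
      where
      expand : ∀ a b c d u v → (a * v + b * u) * (c * v + d * u) ≈ (a * c) * (v * v) + (a * d + b * c) * (u * v) + (b * d) * (u * u)
      expand = solve 6 (λ a b c d u v → (a :* v :+ b :* u) :* (c :* v :+ d :* u) :=
                                        (a :* c) :* (v :* v) :+ (a :* d :+ b :* c) :* (u :* v) :+ (b :* d) :* (u :* u)) refl

    u*v≈quadratic : u * v ≈ quadratic (+ 0) (+ 1) (+ 0)
    u*v≈quadratic = sym (solve 3 (λ X Y Z → con (+ 0) :* X :+ con (+ 1) :* Y :+ con (+ 0) :* Z := Y) refl (v * v) (u * v) (u * u))

    v*linear : ∀ x y → v * linear x y ≈ quadratic x y (+ 0)
    v*linear x y = solve 4 (λ a b u v → v :* (a :* v :+ b :* u) := a :* (v :* v) :+ b :* (u :* v) :+ con (+ 0) :* (u :* u)) refl (ι x) (ι y) u v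

    linear+v : ∀ x y → linear x y + v ≈ linear (x ℤ.+ + 1) y
    linear+v x y = trans (solve 4 (λ a b u v → a :* v :+ b :* u :+ v := (a :+ con (+ 1)) :* v :+ b :* u) refl (ι x) (ι y) u v)
                         (+-congʳ (*-congʳ (sym (+-homo x (+ 1)))))

    quadratic-≡ : ∀ {α μ β α′ μ′ β′} → α ≡ α′ → μ ≡ μ′ → β ≡ β′ → quadratic α μ β ≈ quadratic α′ μ′ β′
    quadratic-≡ ≡.refl ≡.refl ≡.refl = refl

    -- The w- and w²-coefficients of P_{(1+A)/(1+B)}, up to powers of S.
    L : ℕ → ℕ → Carrier
    L A B = linear (+ A) (+ B)

    Q : ℕ → ℕ → Carrier
    Q A B = quadratic (+ tri A) (midℤ (+ A) (+ B)) (+ tri B)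

    L-sum : ∀ A₁ B₁ A₂ B₂ → L A₁ B₁ + L A₂ B₂ ≈ L (A₁ ℕ.+ A₂) (B₁ ℕ.+ B₂)
    L-sum A₁ B₁ A₂ B₂ = trans (linear-+ (+ A₁) (+ B₁) (+ A₂) (+ B₂))
      (reflexive (≡.cong₂ linear (≡.sym (ℤ.pos-+ A₁ A₂)) (≡.sym (ℤ.pos-+ B₁ B₂))))

    Q-sum : ∀ A₁ B₁ A₂ B₂ → Q A₁ B₁ + Q A₂ B₂ + L A₁ B₁ * L A₂ B₂ + u * v ≈ Q (A₁ ℕ.+ A₂) (B₁ ℕ.+ B₂)
    Q-sum A₁ B₁ A₂ B₂ = begin
      Q A₁ B₁ + Q A₂ B₂ + L A₁ B₁ * L A₂ B₂ + u * v
        ≈⟨ +-cong (+-cong (quadratic-+ _ _ _ _ _ _) (linear-* _ _ _ _)) u*v≈quadratic ⟩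
      _ ≈⟨ +-congʳ (quadratic-+ _ _ _ _ _ _) ⟩
      _ ≈⟨ quadratic-+ _ _ _ _ _ _ ⟩
      _ ≈⟨ quadratic-≡ (≡.trans (ℤ.+-identityʳ _) (tri-+ℤ A₁ A₂))
                       (≡.trans (midℤ-+ (+ A₁) (+ B₁) (+ A₂) (+ B₂)) (≡.sym (≡.cong₂ midℤ (ℤ.pos-+ A₁ A₂) (ℤ.pos-+ B₁ B₂))))
                       (≡.trans (ℤ.+-identityʳ _) (tri-+ℤ B₁ B₂)) ⟩
      Q (A₁ ℕ.+ A₂) (B₁ ℕ.+ B₂) ∎

    L-balanced : ∀ {A₁ B₁ A₂ B₂ A B} → A₁ ℕ.+ A₂ ≡ A ℕ.+ A → B₁ ℕ.+ B₂ ≡ B ℕ.+ B →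
                 L A₁ B₁ + L A₂ B₂ ≈ L A B + L A B
    L-balanced {A₁} {B₁} {A₂} {B₂} {A} {B} ΣA ΣB =
      trans (L-sum A₁ B₁ A₂ B₂) (trans (reflexive (≡.cong₂ L ΣA ΣB)) (sym (L-sum A B A B)))

    Q-balanced : ∀ {A₁ B₁ A₂ B₂ A B} → A₁ ℕ.+ A₂ ≡ A ℕ.+ A → B₁ ℕ.+ B₂ ≡ B ℕ.+ B →
                 Q A₁ B₁ + Q A₂ B₂ + L A₁ B₁ * L A₂ B₂ ≈ Q A B + Q A B + L A B * L A B
    Q-balanced {A₁} {B₁} {A₂} {B₂} {A} {B} ΣA ΣB = ∙-cancelʳ (u * v) _ _
      (trans (Q-sum A₁ B₁ A₂ B₂) (trans (reflexive (≡.cong₂ Q ΣA ΣB)) (sym (Q-sum A B A B))))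

    L-left-boundary : ∀ k → L (k ℕ.+ k) (suc k ℕ.+ suc k) ≈ L k (suc k) + L k (suc k)
    L-left-boundary k = sym (L-sum k (suc k) k (suc k))

    Q-left-boundary : ∀ k → Q (k ℕ.+ k) (suc k ℕ.+ suc k) ≈ u * v + (Q k (suc k) + Q k (suc k) + L k (suc k) * L k (suc k))
    Q-left-boundary k = trans (sym (Q-sum k (suc k) k (suc k))) (+-comm _ _)

    L-right-boundary : ∀ t → L 1 (suc t ℕ.+ suc t) ≈ L 0 (suc t) + L 0 (suc t) + v
    L-right-boundary t = sym (trans (+-congʳ (L-sum 0 (suc t) 0 (suc t))) (linear+v _ _))

    Q-right-boundary : ∀ t → Q 1 (suc t ℕ.+ suc t) ≈ Q 0 (suc t) + Q 0 (suc t) + L 0 (suc t) * L 0 (suc t) + v * (L 0 t + L 0 t)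
    Q-right-boundary t = sym (begin
      Q 0 (suc t) + Q 0 (suc t) + L 0 (suc t) * L 0 (suc t) + v * (L 0 t + L 0 t)
        ≈⟨ +-cong (+-cong (quadratic-+ _ _ _ _ _ _) (linear-* _ _ _ _)) (*-congˡ (linear-+ _ _ _ _)) ⟩
      _ ≈⟨ +-cong (quadratic-+ _ _ _ _ _ _) (v*linear _ _) ⟩
      _ ≈⟨ quadratic-+ _ _ _ _ _ _ ⟩
      _ ≈⟨ quadratic-≡ ≡.refl (middle (+ t)) (≡.trans (ℤ.+-identityʳ _) (tri-+ℤ (suc t) (suc t))) ⟩
      Q 1 (suc t ℕ.+ suc t) ∎)
      where
      middle : ∀ T → midℤ (+ 0) (+ 1 ℤ.+ T) ℤ.+ midℤ (+ 0) (+ 1 ℤ.+ T) ℤ.+ (+ 0 ℤ.* (+ 1 ℤ.+ T) ℤ.+ (+ 1 ℤ.+ T) ℤ.* + 0) ℤ.+ (T ℤ.+ T)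
                     ≡ midℤ (+ 1) ((+ 1 ℤ.+ T) ℤ.+ (+ 1 ℤ.+ T))
      middle = expanded
        where
        expanded : ∀ T →
          (+ 0 ℤ.* (+ 1 ℤ.+ T) ℤ.+ (+ 1 ℤ.+ T) ℤ.- + 3 ℤ.* + 0 ℤ.- + 1) ℤ.+ (+ 0 ℤ.* (+ 1 ℤ.+ T) ℤ.+ (+ 1 ℤ.+ T) ℤ.- + 3 ℤ.* + 0 ℤ.- + 1)
            ℤ.+ (+ 0 ℤ.* (+ 1 ℤ.+ T) ℤ.+ (+ 1 ℤ.+ T) ℤ.* + 0) ℤ.+ (T ℤ.+ T)
          ≡ + 1 ℤ.* ((+ 1 ℤ.+ T) ℤ.+ (+ 1 ℤ.+ T)) ℤ.+ ((+ 1 ℤ.+ T) ℤ.+ (+ 1 ℤ.+ T)) ℤ.- + 3 ℤ.* + 1 ℤ.- + 1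
        expanded = ℤ-solve-∀

    record IsMarkovFamily (P : ℕ → ℕ → Carrier) : Set where
      field
        P₀₁ : P 0 1 ≈ 1#
        P₁₀ : P 1 0 ≈ 1#
        P₁₁ : P 1 1 ≈ S
        recurrenceˡ : ∀ p q r s → q ℕ.* r ≡ p ℕ.* s ℕ.+ 1 →
          P (2 ℕ.* p ℕ.+ r) (2 ℕ.* q ℕ.+ s) * P r s
            ≈ u ^ r * v ^ s * w ^ (r ℕ.+ s) * (P p q * P p q) + P (p ℕ.+ r) (q ℕ.+ s) * P (p ℕ.+ r) (q ℕ.+ s)
        recurrenceʳ : ∀ p q r s → q ℕ.* r ≡ p ℕ.* s ℕ.+ 1 →
          P (p ℕ.+ 2 ℕ.* r) (q ℕ.+ 2 ℕ.* s) * P p q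
            ≈ P (p ℕ.+ r) (q ℕ.+ s) * P (p ℕ.+ r) (q ℕ.+ s) + u ^ p * v ^ q * w ^ (p ℕ.+ q) * (P r s * P r s)

    module _ {P : ℕ → ℕ → Carrier} (markov : IsMarkovFamily P) where
      open IsMarkovFamily markov

      -- Stated through equations a ≡ suc A, b ≡ suc B so that it applies to indices like p + r as they stand.
      HasExpansion : ℕ → ℕ → Set
      HasExpansion a b = ∀ {A B} → a ≡ suc A → b ≡ suc B → P a b * S ^ 4 ≈ S ^ suc (A ℕ.+ B) * jet (L A B) (Q A B)

      private
        P-cong : ∀ {a a′ b b′} → a ≡ a′ → b ≡ b′ → P a b ≈ P a′ b′
        P-cong ≡.refl ≡.refl = refl

        intro : ∀ {a b} A B → a ≡ suc A → b ≡ suc B →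
                P a b * S ^ 4 ≈ S ^ suc (A ℕ.+ B) * jet (L A B) (Q A B) → HasExpansion a b
        intro A B ≡.refl ≡.refl expansion ≡.refl ≡.refl = expansion

        monomial-vanishes : ∀ r s t X Y → 3 ≤ t → u ^ r * v ^ s * w ^ t * X + Y ≈ Y
        monomial-vanishes r s t X Y 3≤t = begin
          u ^ r * v ^ s * w ^ t * X + Y  ≈⟨ +-congʳ (*-congʳ (*-congˡ (w^-vanishes t 3≤t))) ⟩
          u ^ r * v ^ s * 0# * X + Y     ≈⟨ +-congʳ (trans (*-congʳ (zeroʳ _)) (zeroˡ X)) ⟩
          0# + Y                         ≈⟨ +-identityˡ Y ⟩
          Y                              ∎

        halve : ∀ {x y z} → suc x ℕ.+ suc y ≡ suc z ℕ.+ suc z → x ℕ.+ y ≡ z ℕ.+ z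
        halve {x} {y} {z} e = ℕ.suc-injective (≡.trans (≡.sym (ℕ.+-suc x y)) (≡.trans (ℕ.suc-injective e) (ℕ.+-suc z z)))

        exponents : ∀ {A₁ B₁ A₂ B₂ A B} → A₁ ℕ.+ A₂ ≡ A ℕ.+ A → B₁ ℕ.+ B₂ ≡ B ℕ.+ B →
                    suc (A₁ ℕ.+ B₁) ℕ.+ suc (A₂ ℕ.+ B₂) ≡ suc (A ℕ.+ B) ℕ.+ suc (A ℕ.+ B)
        exponents {A₁} {B₁} {A₂} {B₂} {A} {B} ΣA ΣB =
          ≡.trans (regroup A₁ B₁ A₂ B₂) (≡.trans (≡.cong₂ (λ x y → 2 ℕ.+ x ℕ.+ y) ΣA ΣB) (≡.sym (regroup A B A B)))
          where
          regroup : ∀ a b c d → suc (a ℕ.+ b) ℕ.+ suc (c ℕ.+ d) ≡ 2 ℕ.+ (a ℕ.+ c) ℕ.+ (b ℕ.+ d)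
          regroup = ℕ-solve-∀

      hasExpansion-balanced : ∀ {a₁ b₁ a₂ b₂ a b} → a₁ ℕ.+ a₂ ≡ a ℕ.+ a → b₁ ℕ.+ b₂ ≡ b ℕ.+ b → 1 ≤ a₂ → 1 ≤ b₂ →
        P a₁ b₁ * P a₂ b₂ ≈ P a b * P a b → HasExpansion a₂ b₂ → HasExpansion a b → HasExpansion a₁ b₁
      hasExpansion-balanced {a = zero}    {b}     Σa _  (s≤s z≤n) _ _ _ _ ≡.refl ≡.refl with () ← Σa
      hasExpansion-balanced {a = suc A}   {zero}  _  Σb _ (s≤s z≤n) _ _ _ ≡.refl ≡.refl with () ← Σb
      hasExpansion-balanced {a₂ = suc A₂} {suc B₂} {suc A} {suc B} Σa Σb (s≤s z≤n) (s≤s z≤n) recurrence expansion₂ expansion {A₁} {B₁} ≡.refl ≡.refl =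
        expansion-balanced {n₁ = suc (A₁ ℕ.+ B₁)} {n₂ = suc (A₂ ℕ.+ B₂)} {n = suc (A ℕ.+ B)}
          (exponents {A₁} {B₁} {A₂} {B₂} {A} {B} ΣA ΣB) (L-balanced ΣA ΣB) (Q-balanced ΣA ΣB)
          recurrence (expansion₂ ≡.refl ≡.refl) (expansion ≡.refl ≡.refl)
        where
        ΣA = halve Σa
        ΣB = halve Σb

      hasExpansion-1/2 : HasExpansion 1 2
      hasExpansion-1/2 = intro 0 1 ≡.refl ≡.refl (begin
        P 1 2 * S ^ 4                                            ≈⟨ *-congʳ P₁₂ ⟩
        (u * w + S * S) * S ^ 4                                  ≈⟨ expand S u v w ⟩
        S ^ 2 * jet (L 0 1) (Q 0 1)                              ∎)
        where
        monomial : ∀ u v w → u ^ 1 * v ^ 0 * w ^ 1 * (1# * 1#) ≈ u * w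
        monomial = solve 3 (λ u v w → u :^ 1 :* v :^ 0 :* w :^ 1 :* (v :^ 0 :* v :^ 0) := u :* w) refl
        P₁₂ : P 1 2 ≈ u * w + S * S
        P₁₂ = begin
          P 1 2                                                  ≈⟨ sym (*-identityʳ _) ⟩
          P 1 2 * 1#                                             ≈⟨ *-congˡ (sym P₁₀) ⟩
          P 1 2 * P 1 0                                          ≈⟨ recurrenceˡ 0 1 1 0 ≡.refl ⟩
          u ^ 1 * v ^ 0 * w ^ 1 * (P 0 1 * P 0 1) + P 1 1 * P 1 1  ≈⟨ +-cong (*-congˡ (*-cong P₀₁ P₀₁)) (*-cong P₁₁ P₁₁) ⟩
          u ^ 1 * v ^ 0 * w ^ 1 * (1# * 1#) + S * S                ≈⟨ +-congʳ (monomial u v w) ⟩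
          u * w + S * S                                          ∎
        expand : ∀ s u v w → (u * w + s * s) * s ^ 4 ≈
          s ^ 2 * (s ^ 4 + w * (s ^ 2 * (ι (+ 0) * v + ι (+ 1) * u)) + (w * w) * (ι (+ 0) * (v * v) + ι (+ 0) * (u * v) + ι (+ 0) * (u * u)))
        expand = solve 4 (λ s u v w → (u :* w :+ s :* s) :* s :^ 4 :=
          s :^ 2 :* (s :^ 4 :+ w :* (s :^ 2 :* (con (+ 0) :* v :+ con (+ 1) :* u)) :+ (w :* w) :* (con (+ 0) :* (v :* v) :+ con (+ 0) :* (u :* v) :+ con (+ 0) :* (u :* u)))) refl

      leading-term-p/p+1 : ∀ p → HasExpansion p (suc p) → (w * w) * P p (suc p) ≈ (w * w) * S ^ (p ℕ.+ p)
      leading-term-p/p+1 zero    _         = *-congˡ P₀₁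
      leading-term-p/p+1 (suc p) expansion = leading-term {n = suc (p ℕ.+ suc p)} (expansion ≡.refl ≡.refl)

      hasExpansion-left-boundary : ∀ p → HasExpansion p (suc p) → HasExpansion (p ℕ.+ 1) (suc p ℕ.+ 1) →
                                   HasExpansion (p ℕ.+ (p ℕ.+ 1)) (suc p ℕ.+ (suc p ℕ.+ 1))
      hasExpansion-left-boundary p expansionₗ expansion = intro (p ℕ.+ p) (suc p ℕ.+ suc p) (twice+1 p) (twice+1 (suc p))
        (expansion-left-boundary {n₁ = suc (p ℕ.+ p ℕ.+ (suc p ℕ.+ suc p))} {n₀ = p ℕ.+ p} {n = suc (p ℕ.+ suc p)}
          (exponent₁ p) (exponent₀ p) (L-left-boundary p) (Q-left-boundary p) recurrence
          (leading-term-p/p+1 p expansionₗ) (expansion (ℕ.+-comm p 1) (ℕ.+-comm (suc p) 1)))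
        where
        twice+1 : ∀ x → x ℕ.+ (x ℕ.+ 1) ≡ suc (x ℕ.+ x)
        twice+1 = ℕ-solve-∀
        exponent₁ : ∀ p → suc (p ℕ.+ p ℕ.+ (suc p ℕ.+ suc p)) ℕ.+ 1 ≡ suc (p ℕ.+ suc p) ℕ.+ suc (p ℕ.+ suc p)
        exponent₁ = ℕ-solve-∀
        exponent₀ : ∀ p → p ℕ.+ p ℕ.+ 2 ≡ suc (p ℕ.+ suc p)
        exponent₀ = ℕ-solve-∀
        twice : ∀ x → 2 ℕ.* x ℕ.+ 1 ≡ x ℕ.+ (x ℕ.+ 1)
        twice = ℕ-solve-∀
        recurrence : P (p ℕ.+ (p ℕ.+ 1)) (suc p ℕ.+ (suc p ℕ.+ 1)) * S
                       ≈ u * v * (w * w) * (P p (suc p) * P p (suc p)) + P (p ℕ.+ 1) (suc p ℕ.+ 1) * P (p ℕ.+ 1) (suc p ℕ.+ 1)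
        recurrence = begin
          P (p ℕ.+ (p ℕ.+ 1)) (suc p ℕ.+ (suc p ℕ.+ 1)) * S
            ≈⟨ *-cong (P-cong (≡.sym (twice p)) (≡.sym (twice (suc p)))) (sym P₁₁) ⟩
          P (2 ℕ.* p ℕ.+ 1) (2 ℕ.* suc p ℕ.+ 1) * P 1 1
            ≈⟨ recurrenceˡ p (suc p) 1 1 (det p) ⟩
          u ^ 1 * v ^ 1 * w ^ 2 * (P p (suc p) * P p (suc p)) + P (p ℕ.+ 1) (suc p ℕ.+ 1) * P (p ℕ.+ 1) (suc p ℕ.+ 1)
            ≈⟨ +-congʳ (*-congʳ (solve 3 (λ u v w → u :^ 1 :* v :^ 1 :* w :^ 2 := u :* v :* (w :* w)) refl u v w)) ⟩
          u * v * (w * w) * (P p (suc p) * P p (suc p)) + P (p ℕ.+ 1) (suc p ℕ.+ 1) * P (p ℕ.+ 1) (suc p ℕ.+ 1) ∎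
          where
          det : ∀ p → suc p ℕ.* 1 ≡ p ℕ.* 1 ℕ.+ 1
          det = ℕ-solve-∀

      hasExpansion-right-boundary : ∀ t Qᵣ → P 1 (suc t) * S ^ 4 ≈ S ^ suc t * jet (L 0 t) Qᵣ →
                                    HasExpansion 1 (suc (suc t)) → HasExpansion 2 (suc (suc t) ℕ.+ suc t)
      hasExpansion-right-boundary t Qᵣ expansionᵣ expansion = intro 1 (suc t ℕ.+ suc t) ≡.refl ≡.refl
        (expansion-right-boundary {n₁ = suc (suc (suc t ℕ.+ suc t))} {nᵣ = suc t} {n = suc (suc t)}
          ≡.refl (exponent t) (L-right-boundary t) (Q-right-boundary t) recurrence expansionᵣ (expansion ≡.refl ≡.refl))
        where
        exponent : ∀ t → suc (suc (suc t ℕ.+ suc t)) ≡ suc (suc t) ℕ.+ suc (suc t)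
        exponent = ℕ-solve-∀
        denominator : ∀ t → 1 ℕ.+ 2 ℕ.* suc t ≡ suc (suc t) ℕ.+ suc t
        denominator = ℕ-solve-∀
        recurrence : P 2 (suc (suc t) ℕ.+ suc t) ≈ P 1 (suc (suc t)) * P 1 (suc (suc t)) + v * w * (P 1 (suc t) * P 1 (suc t))
        recurrence = begin
          P 2 (suc (suc t) ℕ.+ suc t)                            ≈⟨ sym (*-identityʳ _) ⟩
          P 2 (suc (suc t) ℕ.+ suc t) * 1#                       ≈⟨ *-cong (P-cong ≡.refl (≡.sym (denominator t))) (sym P₀₁) ⟩
          P 2 (1 ℕ.+ 2 ℕ.* suc t) * P 0 1                         ≈⟨ recurrenceʳ 0 1 1 (suc t) ≡.refl ⟩
          P 1 (suc (suc t)) * P 1 (suc (suc t)) + u ^ 0 * v ^ 1 * w ^ 1 * (P 1 (suc t) * P 1 (suc t))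
            ≈⟨ +-congˡ (*-congʳ (solve 3 (λ u v w → u :^ 0 :* v :^ 1 :* w :^ 1 := v :* w) refl u v w)) ⟩
          P 1 (suc (suc t)) * P 1 (suc (suc t)) + v * w * (P 1 (suc t) * P 1 (suc t)) ∎

      -- r/s is exempt when it is 1/1: P₁₁ = S does not have the generic expansion (its Q would be −uv).
      record Invariant (p q r s : ℕ) : Set where
        field
          left-end  : HasExpansion p q
          right-end : s ≡ 1 ⊎ HasExpansion r s
          mediant   : HasExpansion (p ℕ.+ r) (q ℕ.+ s)
      open Invariant

      private
        P₁₁-expansion : P 1 1 * S ^ 4 ≈ S ^ 1 * jet (L 0 0) (ι (+ 0))
        P₁₁-expansion = trans (*-congʳ P₁₁) (expand S u v w)
          where
          expand : ∀ s u v w → s * s ^ 4 ≈ s ^ 1 * (s ^ 4 + w * (s ^ 2 * (ι (+ 0) * v + ι (+ 0) * u)) + (w * w) * ι (+ 0))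
          expand = solve 4 (λ s u v w → s :* s :^ 4 :=
            s :^ 1 :* (s :^ 4 :+ w :* (s :^ 2 :* (con (+ 0) :* v :+ con (+ 0) :* u)) :+ (w :* w) :* con (+ 0))) refl

        P₁-expansion : ∀ t → suc t ≡ 1 ⊎ HasExpansion 1 (suc t) → ∃[ Qᵣ ] P 1 (suc t) * S ^ 4 ≈ S ^ suc t * jet (L 0 t) Qᵣ
        P₁-expansion zero    (inj₁ _)         = ι (+ 0) , P₁₁-expansion
        P₁-expansion (suc _) (inj₁ ())
        P₁-expansion t       (inj₂ expansion) = Q 0 t , expansion ≡.refl ≡.refl

        q≡1+p : ∀ {p q} → q ℕ.* 1 ≡ p ℕ.* 1 ℕ.+ 1 → q ≡ suc p
        q≡1+p {p} {q} det = ≡.trans (≡.sym (ℕ.*-identityʳ q)) (≡.trans det (≡.trans (≡.cong (ℕ._+ 1) (ℕ.*-identityʳ p)) (ℕ.+-comm p 1)))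

      left-child : ∀ {p q r s} → IsFareyPair p q r s → Invariant p q r s → HasExpansion (p ℕ.+ (p ℕ.+ r)) (q ℕ.+ (q ℕ.+ s))
      left-child {r = suc (suc _)} {suc zero} farey I with s≤s () ← IsFareyPair.r≤s farey
      left-child {p} {q} {suc zero} {suc zero} farey I with q≡1+p {p} {q} (IsFareyPair.det farey)
      ... | ≡.refl = hasExpansion-left-boundary p (left-end I) (mediant I)
      left-child {p} {q} {suc r} {suc (suc s)} farey I = hasExpansion-balanced (regroup p (suc r)) (regroup q (suc (suc s)))
        (s≤s z≤n) (s≤s z≤n) recurrence expansionᵣ (mediant I)
        where
        regroup : ∀ x y → x ℕ.+ (x ℕ.+ y) ℕ.+ y ≡ x ℕ.+ y ℕ.+ (x ℕ.+ y)
        regroup = ℕ-solve-∀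
        double : ∀ x y → 2 ℕ.* x ℕ.+ y ≡ x ℕ.+ (x ℕ.+ y)
        double = ℕ-solve-∀
        expansionᵣ : HasExpansion (suc r) (suc (suc s))
        expansionᵣ with right-end I
        ... | inj₂ expansion = expansion
        recurrence : P (p ℕ.+ (p ℕ.+ suc r)) (q ℕ.+ (q ℕ.+ suc (suc s))) * P (suc r) (suc (suc s))
                       ≈ P (p ℕ.+ suc r) (q ℕ.+ suc (suc s)) * P (p ℕ.+ suc r) (q ℕ.+ suc (suc s))
        recurrence = trans (*-congʳ (P-cong (≡.sym (double p (suc r))) (≡.sym (double q (suc (suc s))))))
          (trans (recurrenceˡ p q (suc r) (suc (suc s)) (IsFareyPair.det farey))
                 (monomial-vanishes (suc r) (suc (suc s)) _ _ _ (ℕ.+-mono-≤ {1} {suc r} {2} (s≤s z≤n) (s≤s (s≤s z≤n)))))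

      right-child : ∀ {p q r s} → IsFareyPair p q r s → Invariant p q r s → HasExpansion (p ℕ.+ r ℕ.+ r) (q ℕ.+ s ℕ.+ s)
      right-child {zero} {q} {r} {s} farey I with ℕ.m*n≡1⇒m≡1 q r (IsFareyPair.det farey) | ℕ.m*n≡1⇒n≡1 q r (IsFareyPair.det farey)
      right-child {zero} {_} {_} {suc t} farey I | ≡.refl | ≡.refl =
        hasExpansion-right-boundary t (proj₁ expansionᵣ) (proj₂ expansionᵣ) (mediant I)
        where expansionᵣ = P₁-expansion t (right-end I)
      right-child {suc p} {zero}     farey I with () ← p<q farey
      right-child {suc p} {suc zero} farey I with s≤s () ← p<q farey
      right-child {suc p} {suc (suc q)} {r} {s} farey I = hasExpansion-balanced (regroup (suc p) r) (regroup (suc (suc q)) s)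
        (s≤s z≤n) (s≤s z≤n) recurrence (left-end I) (mediant I)
        where
        regroup : ∀ x y → x ℕ.+ y ℕ.+ y ℕ.+ x ≡ x ℕ.+ y ℕ.+ (x ℕ.+ y)
        regroup = ℕ-solve-∀
        double : ∀ x y → x ℕ.+ 2 ℕ.* y ≡ x ℕ.+ y ℕ.+ y
        double = ℕ-solve-∀
        recurrence : P (suc p ℕ.+ r ℕ.+ r) (suc (suc q) ℕ.+ s ℕ.+ s) * P (suc p) (suc (suc q))
                       ≈ P (suc p ℕ.+ r) (suc (suc q) ℕ.+ s) * P (suc p ℕ.+ r) (suc (suc q) ℕ.+ s)
        recurrence = trans (*-congʳ (P-cong (≡.sym (double (suc p) r)) (≡.sym (double (suc (suc q)) s))))
          (trans (recurrenceʳ (suc p) (suc (suc q)) r s (IsFareyPair.det farey))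
                 (trans (+-comm _ _) (monomial-vanishes (suc p) (suc (suc q)) _ _ _ (ℕ.+-mono-≤ {1} {suc p} {2} (s≤s z≤n) (s≤s (s≤s z≤n))))))

      invariant : ∀ {p q r s} → SB p q r s → Invariant p q r s
      invariant root = record { left-end = λ () ; right-end = inj₁ ≡.refl ; mediant = hasExpansion-1/2 }
      invariant (left node) = record
        { left-end  = left-end I
        ; right-end = inj₂ (mediant I)
        ; mediant   = left-child (isFareyPair node) I }
        where I = invariant node
      invariant (right node) = record
        { left-end  = mediant I
        ; right-end = right-end I
        ; mediant   = right-child (isFareyPair node) I }
        where I = invariant node

      hasExpansion : ∀ {a b} → Coprime a b → 1 ≤ a → a < b → HasExpansion a b
      hasExpansion coprime 1≤a a<b with coprime⇒mediant coprime 1≤a a<b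
      ... | record { node = node ; numerator = ≡.refl ; denominator = ≡.refl } = mediant (invariant node)

module PascalLogConcavity where

  open import Data.Nat using (ℕ; zero; suc; _+_; _*_; _≤_; _<_; z≤n; s≤s; >-nonZero)
  import Data.Nat.Properties as ℕ
  open import Data.Nat.Tactic.RingSolver using (solve-∀)
  open import Data.Product using (_×_; _,_; ∃-syntax)
  open import Relation.Nullary using (yes; no)
  open import Relation.Binary.PropositionalEquality using (_≡_; refl; cong; cong₂; sym; trans; subst)
  open ℕ.≤-Reasoning

  -- Multiplication of the generating function by 1 + x.
  pascal : (ℕ → ℕ) → ℕ → ℕ
  pascal y zero    = y zero
  pascal y (suc i) = y i + y (suc i)

  pascal^ : ℕ → (ℕ → ℕ) → ℕ → ℕ
  pascal^ zero    y = y
  pascal^ (suc n) y = pascal (pascal^ n y)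

  IsLogConcave : (ℕ → ℕ) → Set
  IsLogConcave y = ∀ i → y i * y (2 + i) ≤ y (1 + i) * y (1 + i)

  VanishesAbove : ℕ → (ℕ → ℕ) → Set
  VanishesAbove hi y = ∀ i → hi < i → y i ≡ 0

  record PositiveOn (lo hi : ℕ) (y : ℕ → ℕ) : Set where
    field
      lo≤hi      : lo ≤ hi
      positive   : ∀ i → lo ≤ i → i ≤ hi → 0 < y i
      zero-below : ∀ i → i < lo → y i ≡ 0
      zero-above : VanishesAbove hi y

  pascal-vanishesAbove : ∀ {hi y} → VanishesAbove hi y → VanishesAbove (suc hi) (pascal y)
  pascal-vanishesAbove y≡0 (suc i) (s≤s hi<i) = cong₂ _+_ (y≡0 i hi<i) (y≡0 (suc i) (ℕ.m<n⇒m<1+n hi<i))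

  pascal^-vanishesAbove : ∀ n {hi y} → VanishesAbove hi y → VanishesAbove (n + hi) (pascal^ n y)
  pascal^-vanishesAbove zero    y≡0 = y≡0
  pascal^-vanishesAbove (suc n) y≡0 = pascal-vanishesAbove (pascal^-vanishesAbove n y≡0)

  pascal-positiveOn : ∀ {lo hi y} → PositiveOn lo hi y → PositiveOn lo (suc hi) (pascal y)
  pascal-positiveOn {lo} {hi} {y} pos = record
    { lo≤hi      = ℕ.m≤n⇒m≤1+n lo≤hi
    ; positive   = positive′
    ; zero-below = zero-below′
    ; zero-above = pascal-vanishesAbove zero-above }
    where
    open PositiveOn pos
    positive′ : ∀ i → lo ≤ i → i ≤ suc hi → 0 < pascal y i
    positive′ zero    lo≤0 _ = positive zero lo≤0 z≤n
    positive′ (suc i) lo≤1+i 1+i≤1+hi with suc i ℕ.≤? hi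
    ... | yes 1+i≤hi = ℕ.<-≤-trans (positive (suc i) lo≤1+i 1+i≤hi) (ℕ.m≤n+m (y (suc i)) (y i))
    ... | no  1+i≰hi = ℕ.<-≤-trans (positive i (subst (lo ≤_) (sym i≡hi) lo≤hi) (ℕ.≤-pred 1+i≤1+hi)) (ℕ.m≤m+n (y i) (y (suc i)))
      where
      i≡hi : i ≡ hi
      i≡hi = ℕ.suc-injective (ℕ.≤-antisym 1+i≤1+hi (ℕ.≰⇒> 1+i≰hi))
    zero-below′ : ∀ i → i < lo → pascal y i ≡ 0
    zero-below′ zero    0<lo   = zero-below zero 0<lo
    zero-below′ (suc i) 1+i<lo = cong₂ _+_ (zero-below i (ℕ.<-trans (ℕ.n<1+n i) 1+i<lo)) (zero-below (suc i) 1+i<lo)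

  -- Without internal zeros, y₀y₂ ≤ y₁² and y₁y₃ ≤ y₂² multiply to y₀y₃ ≤ y₁y₂.
  logConcave-gap : ∀ {lo hi y} → IsLogConcave y → PositiveOn lo hi y → ∀ k → y k * y (3 + k) ≤ y (1 + k) * y (2 + k)
  logConcave-gap {lo} {hi} {y} lc pos k with y k ℕ.≟ 0 | y (3 + k) ℕ.≟ 0
  ... | yes yₖ≡0 | _ = subst (_≤ y (1 + k) * y (2 + k)) (sym (cong (_* y (3 + k)) yₖ≡0)) z≤n
  ... | no  _    | yes y₃₊ₖ≡0 = subst (_≤ y (1 + k) * y (2 + k)) (sym (trans (cong (y k *_) y₃₊ₖ≡0) (ℕ.*-zeroʳ (y k)))) z≤n
  ... | no  yₖ≢0 | no y₃₊ₖ≢0 = ℕ.*-cancelʳ-≤ _ _ _ {{>-nonZero middle-positive}} (begin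
        (y k * y (3 + k)) * (y (1 + k) * y (2 + k))           ≡⟨ rearrange (y k) (y (1 + k)) (y (2 + k)) (y (3 + k)) ⟩
        (y k * y (2 + k)) * (y (1 + k) * y (3 + k))           ≤⟨ ℕ.*-mono-≤ (lc k) (lc (1 + k)) ⟩
        (y (1 + k) * y (1 + k)) * (y (2 + k) * y (2 + k))     ≡⟨ square (y (1 + k)) (y (2 + k)) ⟩
        (y (1 + k) * y (2 + k)) * (y (1 + k) * y (2 + k))     ∎)
    where
    open PositiveOn pos
    rearrange : ∀ a b c d → (a * d) * (b * c) ≡ (a * c) * (b * d)
    rearrange = solve-∀
    square : ∀ b c → (b * b) * (c * c) ≡ (b * c) * (b * c)
    square = solve-∀
    lo≤k : lo ≤ k
    lo≤k = ℕ.≮⇒≥ (λ k<lo → yₖ≢0 (zero-below k k<lo))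
    3+k≤hi : 3 + k ≤ hi
    3+k≤hi = ℕ.≮⇒≥ (λ hi<3+k → y₃₊ₖ≢0 (zero-above (3 + k) hi<3+k))
    middle-positive : 0 < y (1 + k) * y (2 + k)
    middle-positive = ℕ.*-mono-<
      (positive (1 + k) (ℕ.m≤n⇒m≤1+n lo≤k) (ℕ.≤-trans (ℕ.m≤n+m (1 + k) 2) 3+k≤hi))
      (positive (2 + k) (ℕ.≤-trans lo≤k (ℕ.m≤n+m k 2)) (ℕ.≤-trans (ℕ.m≤n+m (2 + k) 1) 3+k≤hi))

  pascal-logConcave : ∀ {lo hi y} → IsLogConcave y → PositiveOn lo hi y → IsLogConcave (pascal y)
  pascal-logConcave {y = y} lc pos zero = begin
    y 0 * (y 1 + y 2)             ≡⟨ ℕ.*-distribˡ-+ (y 0) (y 1) (y 2) ⟩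
    y 0 * y 1 + y 0 * y 2         ≤⟨ ℕ.+-monoʳ-≤ (y 0 * y 1) (lc 0) ⟩
    y 0 * y 1 + y 1 * y 1         ≤⟨ ℕ.m≤n+m (y 0 * y 1 + y 1 * y 1) (y 0 * y 0 + y 0 * y 1) ⟩
    y 0 * y 0 + y 0 * y 1 + (y 0 * y 1 + y 1 * y 1)  ≡⟨ square (y 0) (y 1) ⟩
    (y 0 + y 1) * (y 0 + y 1)     ∎
    where
    square : ∀ a b → a * a + a * b + (a * b + b * b) ≡ (a + b) * (a + b)
    square = solve-∀
  pascal-logConcave {y = y} lc pos (suc k) = begin
    (y k + y (1 + k)) * (y (2 + k) + y (3 + k))
      ≡⟨ expand (y k) (y (1 + k)) (y (2 + k)) (y (3 + k)) ⟩
    y k * y (2 + k) + y k * y (3 + k) + y (1 + k) * y (2 + k) + y (1 + k) * y (3 + k)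
      ≤⟨ ℕ.+-mono-≤ (ℕ.+-mono-≤ (ℕ.+-mono-≤ (lc k) (logConcave-gap lc pos k)) ℕ.≤-refl) (lc (1 + k)) ⟩
    y (1 + k) * y (1 + k) + y (1 + k) * y (2 + k) + y (1 + k) * y (2 + k) + y (2 + k) * y (2 + k)
      ≡⟨ square (y (1 + k)) (y (2 + k)) ⟩
    (y (1 + k) + y (2 + k)) * (y (1 + k) + y (2 + k)) ∎
    where
    expand : ∀ a b c d → (a + b) * (c + d) ≡ a * c + a * d + b * c + b * d
    expand = solve-∀
    square : ∀ b c → b * b + b * c + b * c + c * c ≡ (b + c) * (b + c)
    square = solve-∀

  pascal^-logConcave : ∀ n {lo hi y} → IsLogConcave y → PositiveOn lo hi y →
                       IsLogConcave (pascal^ n y) × PositiveOn lo (n + hi) (pascal^ n y)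
  pascal^-logConcave zero    lc pos = lc , pos
  pascal^-logConcave (suc n) lc pos with pascal^-logConcave n lc pos
  ... | lcₙ , posₙ = pascal-logConcave lcₙ posₙ , pascal-positiveOn posₙ

  triple : ℕ → ℕ → ℕ → ℕ → ℕ
  triple α μ β 0               = α
  triple α μ β 1               = μ
  triple α μ β 2               = β
  triple α μ β (suc (suc (suc _))) = 0

  triple-vanishesAbove : ∀ α μ β → VanishesAbove 2 (triple α μ β)
  triple-vanishesAbove α μ β (suc (suc (suc _))) _ = refl
  triple-vanishesAbove α μ β 1 (s≤s ())
  triple-vanishesAbove α μ β 2 (s≤s (s≤s ()))

  triple-logConcave : ∀ {α μ β} → α * β ≤ μ * μ → IsLogConcave (triple α μ β)
  triple-logConcave αβ≤μ² zero    = αβ≤μ²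
  triple-logConcave {α} {μ} {β} _ (suc k) = ℕ.≤-trans (ℕ.≤-reflexive (ℕ.*-zeroʳ (triple α μ β (suc k)))) z≤n

  triple-positiveOn : ∀ α {μ β} → 0 < μ → 0 < β → ∃[ lo ] PositiveOn lo 2 (triple α μ β)
  triple-positiveOn zero {μ} {β} 0<μ 0<β = 1 , record
    { lo≤hi = s≤s z≤n
    ; positive = λ { 1 _ _ → 0<μ ; 2 _ _ → 0<β ; (suc (suc (suc _))) _ (s≤s (s≤s ())) }
    ; zero-below = λ { zero _ → refl ; (suc _) (s≤s ()) }
    ; zero-above = triple-vanishesAbove zero μ β }
  triple-positiveOn (suc α) {μ} {β} 0<μ 0<β = 0 , record
    { lo≤hi = z≤n
    ; positive = λ { 0 _ _ → s≤s z≤n ; 1 _ _ → 0<μ ; 2 _ _ → 0<β ; (suc (suc (suc _))) _ (s≤s (s≤s ())) }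
    ; zero-below = λ _ ()
    ; zero-above = triple-vanishesAbove (suc α) μ β }

module Inequalities where

  open import Data.Nat using (ℕ; zero; suc; _+_; _*_; _≤_; _<_; z≤n; s≤s)
  import Data.Nat.Properties as ℕ
  open import Data.Nat.Tactic.RingSolver using (solve-∀)
  open import Relation.Binary.PropositionalEquality using (_≡_; subst; subst₂)
  open CoefficientIdentities using (tri)
  open ℕ.≤-Reasoning

  two-tri≤square : ∀ n → 2 * tri n ≤ n * n
  two-tri≤square zero    = z≤n
  two-tri≤square (suc n) = subst₂ _≤_ (unfoldˡ n (tri n)) (unfoldʳ n)
    (ℕ.+-monoʳ-≤ (2 * n) (ℕ.≤-trans (two-tri≤square n) (ℕ.m≤m+n (n * n) 1)))
    where
    unfoldˡ : ∀ n t → 2 * n + 2 * t ≡ 2 * (n + t)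
    unfoldˡ = solve-∀
    unfoldʳ : ∀ n → 2 * n + (n * n + 1) ≡ suc n * suc n
    unfoldʳ = solve-∀

  private
    linear-bound : ∀ A c → 5 * A ≤ 7 + 3 * c → 3 * A ≤ A * c + 2 * c + 4
    linear-bound zero          c _ = z≤n
    linear-bound (suc zero)    c _ = ℕ.≤-trans (s≤s (s≤s (s≤s z≤n))) (ℕ.m≤n+m 4 (1 * c + 2 * c))
    linear-bound (suc (suc A)) c 5[2+A]≤7+3c = begin
      3 * (2 + A)                 ≤⟨ ℕ.m≤m+n (3 * (2 + A)) (1 + 2 * A) ⟩
      3 * (2 + A) + (1 + 2 * A)   ≡⟨ regroup₁ A ⟩
      4 + (3 + 5 * A)             ≤⟨ ℕ.+-monoʳ-≤ 4 (ℕ.+-cancelˡ-≤ 7 (3 + 5 * A) (3 * c) (subst (_≤ 7 + 3 * c) (regroup₂ A) 5[2+A]≤7+3c)) ⟩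
      4 + 3 * c                   ≤⟨ ℕ.m≤m+n (4 + 3 * c) ((1 + A) * c) ⟩
      4 + 3 * c + (1 + A) * c     ≡⟨ regroup₃ A c ⟩
      (2 + A) * c + 2 * c + 4     ∎
      where
      regroup₁ : ∀ A → 3 * (2 + A) + (1 + 2 * A) ≡ 4 + (3 + 5 * A)
      regroup₁ = solve-∀
      regroup₂ : ∀ A → 5 * (2 + A) ≡ 7 + (3 + 5 * A)
      regroup₂ = solve-∀
      regroup₃ : ∀ A c → 4 + 3 * c + (1 + A) * c ≡ (2 + A) * c + 2 * c + 4
      regroup₃ = solve-∀

  triangular-bound : ∀ A c → 5 * suc A ≤ 3 * (4 + c) → tri A * tri (3 + c) ≤ (suc A * c + 2) * (suc A * c + 2)
  triangular-bound A c 5a≤3b = ℕ.*-cancelˡ-≤ 4 (begin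
    4 * (tri A * tri B)           ≡⟨ regroup₁ (tri A) (tri B) ⟩
    (2 * tri A) * (2 * tri B)     ≤⟨ ℕ.*-mono-≤ (two-tri≤square A) (two-tri≤square B) ⟩
    (A * A) * (B * B)             ≡⟨ regroup₂ A B ⟩
    (A * B) * (A * B)             ≤⟨ ℕ.*-mono-≤ AB≤2μ AB≤2μ ⟩
    (2 * μ) * (2 * μ)             ≡⟨ regroup₃ μ ⟩
    4 * (μ * μ)                   ∎)
    where
    B μ : ℕ
    B = 3 + c
    μ = suc A * c + 2
    regroup₁ : ∀ x y → 4 * (x * y) ≡ (2 * x) * (2 * y)
    regroup₁ = solve-∀
    regroup₂ : ∀ x y → (x * x) * (y * y) ≡ (x * y) * (x * y)
    regroup₂ = solve-∀
    regroup₃ : ∀ m → (2 * m) * (2 * m) ≡ 4 * (m * m)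
    regroup₃ = solve-∀
    regroup₄ : ∀ A → 5 * suc A ≡ 5 + 5 * A
    regroup₄ = solve-∀
    regroup₅ : ∀ c → 3 * (4 + c) ≡ 5 + (7 + 3 * c)
    regroup₅ = solve-∀
    regroup₆ : ∀ A c → A * (3 + c) ≡ 3 * A + A * c
    regroup₆ = solve-∀
    regroup₇ : ∀ A c → A * c + 2 * c + 4 + A * c ≡ 2 * (suc A * c + 2)
    regroup₇ = solve-∀
    5A≤7+3c : 5 * A ≤ 7 + 3 * c
    5A≤7+3c = ℕ.+-cancelˡ-≤ 5 (5 * A) (7 + 3 * c) (subst₂ _≤_ (regroup₄ A) (regroup₅ c) 5a≤3b)
    AB≤2μ : A * B ≤ 2 * μ
    AB≤2μ = begin
      A * (3 + c)                     ≡⟨ regroup₆ A c ⟩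
      3 * A + A * c                   ≤⟨ ℕ.+-monoˡ-≤ (A * c) (linear-bound A c 5A≤7+3c) ⟩
      A * c + 2 * c + 4 + A * c       ≡⟨ regroup₇ A c ⟩
      2 * (suc A * c + 2)             ∎

  5a≤3b⇒a<b : ∀ {a b} → 1 ≤ a → 5 * a ≤ 3 * b → a < b
  5a≤3b⇒a<b {suc A} {b} _ 5a≤3b = ℕ.*-cancelˡ-< 3 (suc A) b (ℕ.<-≤-trans (ℕ.*-monoˡ-< (suc A) {3} {5} (s≤s (s≤s (s≤s (s≤s z≤n))))) 5a≤3b)

  5a≤3b⇒4≤b : ∀ {a b} → 5 * a ≤ 3 * b → 5 ≤ a + b → 4 ≤ b
  5a≤3b⇒4≤b {a} {b} 5a≤3b 5≤a+b = ℕ.≮⇒≥ λ b<4 → ℕ.1+n≰n (begin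
    10        ≤⟨ ℕ.*-monoʳ-≤ 5 (ℕ.+-cancelʳ-≤ 3 2 a (ℕ.≤-trans 5≤a+b (ℕ.+-monoʳ-≤ a (ℕ.≤-pred b<4)))) ⟩
    5 * a     ≤⟨ 5a≤3b ⟩
    3 * b     ≤⟨ ℕ.*-monoʳ-≤ 3 (ℕ.≤-pred b<4) ⟩
    9         ∎)

module Windows where

  open import Data.Nat as ℕ using (ℕ; zero; suc; _+_; _≤_)
  import Data.Nat.Properties as ℕ
  open import Data.Integer as ℤ using (ℤ)
  open import Data.List using (List; []; _∷_; map; filter; upTo; applyUpTo)
  open import Data.List.Properties using (filter-all; filter-accept; filter-reject)
  open import Data.List.Relation.Unary.All using (All; []; _∷_)
  open import Data.List.Relation.Unary.All.Properties using (applyUpTo⁺₁; filter⁺)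
  open import Data.List.Relation.Unary.Linked using (Linked; []; [-]; _∷_)
  open import Data.Product using (_,_)
  open import Data.Unit using (tt)
  open import Relation.Nullary using (Dec; yes; no)
  open import Relation.Unary using (Pred; Decidable)
  open import Relation.Binary.PropositionalEquality using (_≡_; refl; sym; trans; cong; subst)
  open import Defs using (LogConcave)
  open import Level using (0ℓ)

  Consecutive : List ℕ → Set
  Consecutive = Linked (λ i j → j ≡ suc i)

  UpwardClosed : Pred ℕ 0ℓ → Set
  UpwardClosed P = ∀ {i} → P i → P (suc i)

  applyUpTo-consecutive : ∀ f n → (∀ i → f (suc i) ≡ suc (f i)) → Consecutive (applyUpTo f n)
  applyUpTo-consecutive f zero          _    = []
  applyUpTo-consecutive f (suc zero)    _    = [-]
  applyUpTo-consecutive f (suc (suc n)) step = step 0 ∷ applyUpTo-consecutive (λ i → f (suc i)) (suc n) (λ i → step (suc i))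

  module _ {P : Pred ℕ 0ℓ} (P? : Decidable P) (upward : UpwardClosed P) where

    private
      all-from : ∀ {x xs} → P x → Consecutive (x ∷ xs) → All P (x ∷ xs)
      all-from px [-]         = px ∷ []
      all-from px (refl ∷ xs) = px ∷ all-from (upward px) xs

    filter-consecutive : ∀ {xs} → Consecutive xs → Consecutive (filter P? xs)
    filter-consecutive []                   = []
    filter-consecutive ([-] {x})            = singleton (P? x)
      where
      singleton : Dec (P x) → Consecutive (filter P? (x ∷ []))
      singleton (yes px) = subst Consecutive (sym (filter-accept P? px)) [-]
      singleton (no ¬px) = subst Consecutive (sym (filter-reject P? ¬px)) []
    filter-consecutive (_∷_ {x} {_} {xs} refl y∷xs) = cons (P? x)
      where
      cons : Dec (P x) → Consecutive (filter P? (x ∷ suc x ∷ xs))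
      cons (yes px) = subst Consecutive (sym (trans (filter-accept P? px) (cong (x ∷_) (filter-all P? (all-from (upward px) y∷xs)))))
                            (refl ∷ y∷xs)
      cons (no ¬px) = subst Consecutive (sym (filter-reject P? ¬px)) (filter-consecutive y∷xs)

  logConcave-map : ∀ (F : ℕ → ℤ) N → (∀ k → 2 + k ≤ N → F k ℤ.* F (2 + k) ℤ.≤ F (1 + k) ℤ.* F (1 + k)) →
                   ∀ {xs} → Consecutive xs → All (_≤ N) xs → LogConcave (map F xs)
  logConcave-map F N lc []                   _                       = tt
  logConcave-map F N lc [-]                  _                       = tt
  logConcave-map F N lc (_ ∷ [-])            _                       = tt
  logConcave-map F N lc (refl ∷ refl ∷ rest) (_ ∷ bounds@(_ ∷ 2+k≤N ∷ _)) =
    lc _ 2+k≤N , logConcave-map F N lc (refl ∷ rest) bounds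

  logConcave-window : ∀ (F : ℕ → ℤ) N → (∀ k → 2 + k ≤ N → F k ℤ.* F (2 + k) ℤ.≤ F (1 + k) ℤ.* F (1 + k)) →
                      ∀ {P : Pred ℕ 0ℓ} (P? : Decidable P) → UpwardClosed P → LogConcave (map F (filter P? (upTo (suc N))))
  logConcave-window F N lc P? upward = logConcave-map F N lc
    (filter-consecutive P? upward (applyUpTo-consecutive (λ i → i) (suc N) (λ _ → refl)))
    (filter⁺ P? (applyUpTo⁺₁ (λ i → i) (suc N) ℕ.≤-pred))

module LineCoefficients where

  open import Algebra.Bundles using (CommutativeRing)
  open import Data.Nat as ℕ using (ℕ; zero; suc; _∸_; _≤_; _<_; z≤n; s≤s)
  import Data.Nat.Properties as ℕ
  open import Data.Nat.Coprimality using (Coprime)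
  open import Data.Integer as ℤ using (ℤ; +_; 0ℤ)
  import Data.Integer.Properties as ℤ
  open import Data.Sum using (inj₂)
  open import Data.Product using (proj₁; proj₂)
  open import Relation.Nullary.Negation using (contradiction)
  open import Relation.Binary.PropositionalEquality as ≡ using (_≡_; refl; cong; cong₂; sym; trans)
  open import Data.Nat.Tactic.RingSolver using () renaming (solve-∀ to ℕ-solve-∀)
  open import Data.Integer.Tactic.RingSolver using () renaming (solve-∀ to ℤ-solve-∀)
  open import Defs
  open Monomials
  open SeriesRing
  open Variables
  open CoefficientIdentities
  open PascalLogConcavity
  open Inequalities
  open Windows

  open Expansion seriesRing using (module Jet)
  open Jet ι-morphism u v w w³≈0 u+v-regular

  open import Algebra.Properties.Semiring.Exp (CommutativeRing.semiring seriesRing) using (_^_)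

  private
    ring-form : ∀ f g h k m → f ⊗ g ≋ h ⊗ (k ⊗ k) ⊕ m ⊗ m → f * g ≈ h * (k * k) + m * m
    ring-form f g h k m e = ≈-trans (≈-sym (⊗-is-* f g))
      (≈-trans (≋⇒≈ e) (+-cong (≈-trans (⊗-is-* h (k ⊗ k)) (*-congˡ {h} (⊗-is-* k k))) (⊗-is-* m m)))

    ring-form′ : ∀ f g h k m → f ⊗ g ≋ m ⊗ m ⊕ h ⊗ (k ⊗ k) → f * g ≈ m * m + h * (k * k)
    ring-form′ f g h k m e = ≈-trans (≈-sym (⊗-is-* f g))
      (≈-trans (≋⇒≈ e) (+-cong (⊗-is-* m m) (≈-trans (⊗-is-* h (k ⊗ k)) (*-congˡ {h} (⊗-is-* k k)))))

  markovFamily : ∀ {P} → IsMarkovNumerators P → IsMarkovFamily P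
  markovFamily {P} markov = record
    { P₀₁ = ≈-trans (≋⇒≈ base01) mono-000
    ; P₁₀ = ≈-trans (≋⇒≈ base10) mono-000
    ; P₁₁ = ≋⇒≈ base11
    ; recurrenceˡ = λ p q r s det →
        ≈-trans (ring-form (P (2 ℕ.* p ℕ.+ r) (2 ℕ.* q ℕ.+ s)) (P r s) (mono r s (r ℕ.+ s)) (P p q) (P (p ℕ.+ r) (q ℕ.+ s))
                           (stepL p q r s det))
                (+-congʳ {P (p ℕ.+ r) (q ℕ.+ s) * P (p ℕ.+ r) (q ℕ.+ s)}
                         (*-congʳ {P p q * P p q} (mono-power r s (r ℕ.+ s))))
    ; recurrenceʳ = λ p q r s det →
        ≈-trans (ring-form′ (P (p ℕ.+ 2 ℕ.* r) (q ℕ.+ 2 ℕ.* s)) (P p q) (mono p q (p ℕ.+ q)) (P r s) (P (p ℕ.+ r) (q ℕ.+ s))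
                            (stepR p q r s det))
                (+-congˡ {P (p ℕ.+ r) (q ℕ.+ s) * P (p ℕ.+ r) (q ℕ.+ s)}
                         (*-congʳ {P r s * P r s} (mono-power p q (p ℕ.+ q))))
    }
    where open IsMarkovNumerators markov

  record WFree (X : Series) : Set where
    field w-coefficient : ∀ i j k → X i j (suc k) ≡ 0ℤ
  open WFree

  wFree-+ : ∀ {X Y} → WFree X → WFree Y → WFree (X + Y)
  wFree-+ X-free Y-free .w-coefficient i j k = cong₂ ℤ._+_ (w-coefficient X-free i j k) (w-coefficient Y-free i j k)

  wFree-* : ∀ {X Y} → WFree X → WFree Y → WFree (X * Y)
  wFree-* {X} {Y} X-free Y-free .w-coefficient i j k = trans (sym (⊗-coeff X Y i j (suc k)))
    (sumTo-zero i _ (λ i₁ _ → sumTo-zero j _ (λ j₁ _ → sumTo-zero (suc k) _ (λ k₁ _ → term i₁ j₁ k₁))))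
    where
    term : ∀ i₁ j₁ k₁ → X i₁ j₁ k₁ ℤ.* Y (i ∸ i₁) (j ∸ j₁) (suc k ∸ k₁) ≡ 0ℤ
    term i₁ j₁ zero     = trans (cong (X i₁ j₁ 0 ℤ.*_) (w-coefficient Y-free (i ∸ i₁) (j ∸ j₁) k)) (ℤ.*-zeroʳ (X i₁ j₁ 0))
    term i₁ j₁ (suc k₁) = trans (cong (ℤ._* Y (i ∸ i₁) (j ∸ j₁) (k ∸ k₁)) (w-coefficient X-free i₁ j₁ k₁))
                                (ℤ.*-zeroˡ (Y (i ∸ i₁) (j ∸ j₁) (k ∸ k₁)))

  wFree-mono : ∀ r s → WFree (mono r s 0)
  wFree-mono r s .w-coefficient i j k = mono-off r s 0 i j (suc k) (inj₂ (inj₂ (λ ())))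

  wFree-ι : ∀ c → WFree (ι c)
  wFree-ι c .w-coefficient zero    zero    k = refl
  wFree-ι c .w-coefficient zero    (suc j) k = refl
  wFree-ι c .w-coefficient (suc i) j       k = refl

  wFree-1 : WFree 1#
  wFree-1 .w-coefficient zero    zero    k = refl
  wFree-1 .w-coefficient zero    (suc j) k = refl
  wFree-1 .w-coefficient (suc i) j       k = refl

  wFree-S^ : ∀ n → WFree (S ^ n)
  wFree-S^ zero    = wFree-1
  wFree-S^ (suc n) = wFree-* (wFree-+ (wFree-mono 1 0) (wFree-mono 0 1)) (wFree-S^ n)

  wFree-L : ∀ A B → WFree (L A B)
  wFree-L A B = wFree-+ (wFree-* (wFree-ι (+ A)) (wFree-mono 0 1)) (wFree-* (wFree-ι (+ B)) (wFree-mono 1 0))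

  wFree-quadratic : ∀ α μ β → WFree (quadratic α μ β)
  wFree-quadratic α μ β = wFree-+ (wFree-+ (wFree-* (wFree-ι α) (wFree-* (wFree-mono 0 1) (wFree-mono 0 1)))
                                           (wFree-* (wFree-ι μ) (wFree-* (wFree-mono 1 0) (wFree-mono 0 1))))
                                  (wFree-* (wFree-ι β) (wFree-* (wFree-mono 1 0) (wFree-mono 1 0)))

  w²-coefficient : ∀ n {L Q} → WFree L → WFree Q → ∀ i j → (S ^ n * jet L Q) i j 2 ≡ (S ^ n * Q) i j 0
  w²-coefficient n {L} {Q} L-free Q-free i j = begin
    (S ^ n * jet L Q) i j 2
      ≡⟨ at (expand (S ^ n) S w L Q) i j 2 (s≤s (s≤s (s≤s z≤n))) ⟩
    (S ^ n * S ^ 4) i j 2 ℤ.+ (w * (S ^ n * S ^ 2 * L)) i j 2 ℤ.+ (w * (w * (S ^ n * Q))) i j 2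
      ≡⟨ cong₂ ℤ._+_ (cong₂ ℤ._+_ (w-coefficient (wFree-* (wFree-S^ n) (wFree-S^ 4)) i j 1)
                                  (trans (w-shift (S ^ n * S ^ 2 * L) i j 1) (w-coefficient (wFree-* (wFree-* (wFree-S^ n) (wFree-S^ 2)) L-free) i j 0)))
                     (trans (w-shift (w * (S ^ n * Q)) i j 1) (w-shift (S ^ n * Q) i j 0)) ⟩
    0ℤ ℤ.+ 0ℤ ℤ.+ (S ^ n * Q) i j 0
      ≡⟨ ℤ.+-identityˡ _ ⟩
    (S ^ n * Q) i j 0 ∎
    where
    open ≡.≡-Reasoning
    open Solver using (solve; _:+_; _:*_; _:^_; _:=_)
    expand : ∀ p s w L Q → p * (s ^ 4 + w * (s ^ 2 * L) + (w * w) * Q) ≈ p * s ^ 4 + w * (p * s ^ 2 * L) + w * (w * (p * Q))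
    expand = solve 5 (λ p s w L Q → p :* (s :^ 4 :+ w :* (s :^ 2 :* L) :+ (w :* w) :* Q) :=
                                    p :* s :^ 4 :+ w :* (p :* s :^ 2 :* L) :+ w :* (w :* (p :* Q))) ≈-refl

  ι-scale : ∀ c Y i j k → (ι c * Y) i j k ≡ c ℤ.* Y i j k
  ι-scale c Y i j k = trans (sym (⊗-coeff (ι c) Y i j k))
    (trans (sumTo-single i 0 _ (λ { zero 0≢0 → contradiction refl 0≢0
                                   ; (suc x) _ → sumTo-zero j _ (λ y _ → sumTo-zero k _ (λ z _ → ℤ.*-zeroˡ (Y (i ∸ suc x) (j ∸ y) (k ∸ z)))) }) z≤n)
    (trans (sumTo-single j 0 _ (λ { zero 0≢0 → contradiction refl 0≢0
                                   ; (suc y) _ → sumTo-zero k _ (λ z _ → ℤ.*-zeroˡ (Y i (j ∸ suc y) (k ∸ z))) }) z≤n)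
           (sumTo-single k 0 _ (λ { zero 0≢0 → contradiction refl 0≢0 ; (suc z) _ → ℤ.*-zeroˡ (Y i j (k ∸ suc z)) }) z≤n)))

  quadratic-coefficient : ∀ α μ β i j → i ℕ.+ j ≡ 2 → quadratic (+ α) (+ μ) (+ β) i j 0 ≡ + triple α μ β i
  quadratic-coefficient α μ β i j i+j≡2 = trans
    (cong₂ ℤ._+_ (cong₂ ℤ._+_ (term (+ α) (mono-* 0 1 0 0 1 0)) (term (+ μ) (mono-* 1 0 0 0 1 0))) (term (+ β) (mono-* 1 0 0 1 0 0)))
    (on-line i j i+j≡2)
    where
    term : ∀ c {X M} → X ≈ M → (ι c * X) i j 0 ≡ c ℤ.* M i j 0
    term c {X} X≈M = trans (ι-scale c X i j 0) (cong (c ℤ.*_) (at X≈M i j 0 (s≤s z≤n)))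
    first : ∀ a b c → a ℤ.* + 1 ℤ.+ b ℤ.* + 0 ℤ.+ c ℤ.* + 0 ≡ a
    first = ℤ-solve-∀
    second : ∀ a b c → a ℤ.* + 0 ℤ.+ b ℤ.* + 1 ℤ.+ c ℤ.* + 0 ≡ b
    second = ℤ-solve-∀
    third : ∀ a b c → a ℤ.* + 0 ℤ.+ b ℤ.* + 0 ℤ.+ c ℤ.* + 1 ≡ c
    third = ℤ-solve-∀
    on-line : ∀ i j → i ℕ.+ j ≡ 2 →
      + α ℤ.* mono 0 2 0 i j 0 ℤ.+ + μ ℤ.* mono 1 1 0 i j 0 ℤ.+ + β ℤ.* mono 2 0 0 i j 0 ≡ + triple α μ β i
    on-line 0 2 refl = first (+ α) (+ μ) (+ β)
    on-line 1 1 refl = second (+ α) (+ μ) (+ β)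
    on-line 2 0 refl = third (+ α) (+ μ) (+ β)

  line-coefficient : ∀ X h (y : ℕ → ℕ) → (∀ i j → i ℕ.+ j ≡ h → X i j 0 ≡ + y i) → VanishesAbove h y →
                     ∀ n i j → i ℕ.+ j ≡ n ℕ.+ h → (S ^ n * X) i j 0 ≡ + pascal^ n y i
  line-coefficient X h y base _ zero i j i+j≡h = trans (at (*-identityˡ X) i j 0 (s≤s z≤n)) (base i j i+j≡h)
  line-coefficient X h y base y-vanishes (suc n) i j i+j≡ =
    trans (at (≈-trans (*-assoc S (S ^ n) X) (distribʳ (S ^ n * X) u v)) i j 0 (s≤s z≤n)) (split i j i+j≡)
    where
    Z = S ^ n * X
    IH : ∀ i j → i ℕ.+ j ≡ n ℕ.+ h → Z i j 0 ≡ + pascal^ n y i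
    IH = line-coefficient X h y base y-vanishes n
    split : ∀ i j → i ℕ.+ j ≡ suc n ℕ.+ h → (u * Z) i j 0 ℤ.+ (v * Z) i j 0 ≡ + pascal^ (suc n) y i
    split zero    (suc j) e = trans (cong₂ ℤ._+_ (u-zero Z (suc j) 0) (v-shift Z 0 j 0))
                                    (trans (ℤ.+-identityˡ _) (IH 0 j (ℕ.suc-injective e)))
    split (suc i) zero    e = trans (cong₂ ℤ._+_ (u-shift Z i 0 0) (v-zero Z (suc i) 0))
      (trans (ℤ.+-identityʳ _) (trans (IH i 0 (ℕ.suc-injective e))
        (cong +_ (sym (trans (cong (pascal^ n y i ℕ.+_) beyond) (ℕ.+-identityʳ _))))))
      where
      beyond : pascal^ n y (suc i) ≡ 0
      beyond = pascal^-vanishesAbove n y-vanishes (suc i) (ℕ.≤-reflexive (≡.cong suc (≡.sym (≡.trans (≡.sym (ℕ.+-identityʳ i)) (ℕ.suc-injective e)))))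
    split (suc i) (suc j) e = trans (cong₂ ℤ._+_ (u-shift Z i (suc j) 0) (v-shift Z (suc i) j 0))
      (trans (cong₂ ℤ._+_ (IH i (suc j) (ℕ.suc-injective e)) (IH (suc i) j (≡.trans (≡.sym (ℕ.+-suc i j)) (ℕ.suc-injective e))))
             (sym (ℤ.pos-+ (pascal^ n y i) (pascal^ n y (suc i)))))

  private
    ∸-≤-suc : ∀ N i → N ∸ i ≤ suc (N ∸ suc i)
    ∸-≤-suc zero    zero    = z≤n
    ∸-≤-suc zero    (suc i) = z≤n
    ∸-≤-suc (suc N) zero    = ℕ.≤-refl
    ∸-≤-suc (suc N) (suc i) = ∸-≤-suc N i

    two-above : ∀ M i → i ≤ M → suc (suc M) ∸ i ∸ (M ∸ i) ≡ 2
    two-above M       zero    _         = ℕ.m+n∸n≡m 2 M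
    two-above (suc M) (suc i) (s≤s i≤M) = two-above M i i≤M

  above-line-upward : ∀ {a b} N → a ≤ b → UpwardClosed (λ i → a ℕ.* b ≤ i ℕ.* b ℕ.+ (N ∸ i) ℕ.* a)
  above-line-upward {a} {b} N a≤b {i} ab≤ = ℕ.≤-trans ab≤ (begin
    i ℕ.* b ℕ.+ (N ∸ i) ℕ.* a              ≤⟨ ℕ.+-monoʳ-≤ (i ℕ.* b) (ℕ.*-monoˡ-≤ a (∸-≤-suc N i)) ⟩
    i ℕ.* b ℕ.+ (a ℕ.+ (N ∸ suc i) ℕ.* a)  ≤⟨ ℕ.+-monoʳ-≤ (i ℕ.* b) (ℕ.+-monoˡ-≤ ((N ∸ suc i) ℕ.* a) a≤b) ⟩
    i ℕ.* b ℕ.+ (b ℕ.+ (N ∸ suc i) ℕ.* a)  ≡⟨ sym (ℕ.+-assoc (i ℕ.* b) b _) ⟩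
    i ℕ.* b ℕ.+ b ℕ.+ (N ∸ suc i) ℕ.* a    ≡⟨ cong (ℕ._+ (N ∸ suc i) ℕ.* a) (ℕ.+-comm (i ℕ.* b) b) ⟩
    suc i ℕ.* b ℕ.+ (N ∸ suc i) ℕ.* a      ∎)
    where open ℕ.≤-Reasoning

  line : (ℕ → ℕ → Series) → ℕ → ℕ → ℕ → ℤ
  line P a b i = coeffA P a b i (a ℕ.+ b ∸ 3 ∸ i)

  line-values : ∀ {P} → IsMarkovNumerators P → ∀ A c → Coprime (suc A) (4 ℕ.+ c) → suc A < 4 ℕ.+ c →
    ∀ i → i ≤ suc A ℕ.+ (4 ℕ.+ c) ∸ 3 → line P (suc A) (4 ℕ.+ c) i ≡ + pascal^ (A ℕ.+ c) (triple (tri A) (suc A ℕ.* c ℕ.+ 2) (tri (3 ℕ.+ c))) i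
  line-values {P} markov A c coprime a<b i i≤N = begin
    P a b i (N ∸ i) (a ℕ.+ b ∸ 1 ∸ i ∸ (N ∸ i))          ≡⟨ cong (P a b i (N ∸ i)) w-exponent ⟩
    P a b i (N ∸ i) 2                                      ≡⟨ at P≈ i (N ∸ i) 2 (s≤s (s≤s (s≤s z≤n))) ⟩
    (S ^ n * jet (L A B) (Q A B)) i (N ∸ i) 2              ≡⟨ w²-coefficient n (wFree-L A B) (wFree-quadratic _ _ _) i (N ∸ i) ⟩
    (S ^ n * Q A B) i (N ∸ i) 0                            ≡⟨ at (*-congˡ {S ^ n} (quadratic-≡ refl (midℤ≡a[b∸4]+2 A c) refl)) i (N ∸ i) 0 (s≤s z≤n) ⟩
    (S ^ n * quadratic (+ tri A) (+ μ) (+ tri B)) i (N ∸ i) 0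
      ≡⟨ line-coefficient (quadratic (+ tri A) (+ μ) (+ tri B)) 2 (triple (tri A) μ (tri B))
                          (quadratic-coefficient (tri A) μ (tri B)) (triple-vanishesAbove (tri A) μ (tri B)) n i (N ∸ i) on-line ⟩
    + pascal^ n (triple (tri A) μ (tri B)) i               ∎
    where
    open ≡.≡-Reasoning
    a b B n μ N : ℕ
    a = suc A
    b = 4 ℕ.+ c
    B = 3 ℕ.+ c
    n = A ℕ.+ c
    μ = suc A ℕ.* c ℕ.+ 2
    N = a ℕ.+ b ∸ 3
    regroup : ∀ A c → A ℕ.+ (4 ℕ.+ c) ≡ 2 ℕ.+ (2 ℕ.+ (A ℕ.+ c))
    regroup = ℕ-solve-∀
    N≡ : N ≡ 2 ℕ.+ n
    N≡ = cong (_∸ 2) (regroup A c)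
    w-exponent : a ℕ.+ b ∸ 1 ∸ i ∸ (N ∸ i) ≡ 2
    w-exponent = trans (cong (λ M → M ∸ i ∸ (N ∸ i)) (trans (regroup A c) (cong (2 ℕ.+_) (sym N≡)))) (two-above N i i≤N)
    on-line : i ℕ.+ (N ∸ i) ≡ n ℕ.+ 2
    on-line = trans (ℕ.m+[n∸m]≡n i≤N) (trans N≡ (ℕ.+-comm 2 n))
    exponent : ∀ A c → suc (A ℕ.+ (3 ℕ.+ c)) ≡ A ℕ.+ c ℕ.+ 4
    exponent = ℕ-solve-∀
    P≈ : P a b ≈ S ^ n * jet (L A B) (Q A B)
    P≈ = divide-S⁴ n {P a b} {jet (L A B) (Q A B)} (exponent A c)
           (hasExpansion (markovFamily markov) coprime (s≤s z≤n) a<b refl refl)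

  private
    five≤a+b : ∀ {a b k} → 2 ℕ.+ k ≤ a ℕ.+ b ∸ 3 → 5 ≤ a ℕ.+ b
    five≤a+b {a} {b} {k} 2+k≤N = ℕ.≮⇒≥ λ a+b<5 →
      ℕ.1+n≰n (ℕ.≤-trans (ℕ.≤-trans (ℕ.m≤m+n 2 k) 2+k≤N) (ℕ.∸-monoˡ-≤ 3 (ℕ.≤-pred a+b<5)))

    logConcave-ℤ : ∀ {x y z} → x ℕ.* z ≤ y ℕ.* y → + x ℤ.* + z ℤ.≤ + y ℤ.* + y
    logConcave-ℤ {x} {y} {z} xz≤y² = ≡.subst₂ ℤ._≤_ (ℤ.pos-* x z) (ℤ.pos-* y y) (ℤ.+≤+ xz≤y²)

    line-logConcave-4≤b : ∀ {P} → IsMarkovNumerators P → ∀ {a b} → Coprime a b → 1 ≤ a → 5 ℕ.* a ≤ 3 ℕ.* b → 4 ≤ b →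
      ∀ k → 2 ℕ.+ k ≤ a ℕ.+ b ∸ 3 → line P a b k ℤ.* line P a b (2 ℕ.+ k) ℤ.≤ line P a b (1 ℕ.+ k) ℤ.* line P a b (1 ℕ.+ k)
    line-logConcave-4≤b {P} markov {suc A} {suc (suc (suc (suc c)))} coprime (s≤s z≤n) 5a≤3b (s≤s (s≤s (s≤s (s≤s _)))) k 2+k≤N =
      ≡.subst₂ ℤ._≤_ (sym (cong₂ ℤ._*_ (value k (ℕ.m≤n+m k 2)) (value (2 ℕ.+ k) ℕ.≤-refl)))
                     (sym (cong₂ ℤ._*_ (value (1 ℕ.+ k) (ℕ.n≤1+n _)) (value (1 ℕ.+ k) (ℕ.n≤1+n _))))
                     (logConcave-ℤ {y k} {y (1 ℕ.+ k)} {y (2 ℕ.+ k)} (y-logConcave k))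
      where
      μ : ℕ
      μ = suc A ℕ.* c ℕ.+ 2
      y : ℕ → ℕ
      y = pascal^ (A ℕ.+ c) (triple (tri A) μ (tri (3 ℕ.+ c)))
      y-logConcave : IsLogConcave y
      y-logConcave = proj₁ (pascal^-logConcave (A ℕ.+ c) (triple-logConcave (triangular-bound A c 5a≤3b))
                             (proj₂ (triple-positiveOn (tri A) (ℕ.≤-trans (s≤s z≤n) (ℕ.m≤n+m 2 (suc A ℕ.* c))) (s≤s z≤n))))
      value : ∀ i → i ≤ 2 ℕ.+ k → line P (suc A) (4 ℕ.+ c) i ≡ + y i
      value i i≤2+k = line-values markov A c coprime (5a≤3b⇒a<b (s≤s z≤n) 5a≤3b) i (ℕ.≤-trans i≤2+k 2+k≤N)

  line-logConcave : ∀ {P} → IsMarkovNumerators P → ∀ {a b} → Coprime a b → 1 ≤ a → 5 ℕ.* a ≤ 3 ℕ.* b →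
    ∀ k → 2 ℕ.+ k ≤ a ℕ.+ b ∸ 3 → line P a b k ℤ.* line P a b (2 ℕ.+ k) ℤ.≤ line P a b (1 ℕ.+ k) ℤ.* line P a b (1 ℕ.+ k)
  line-logConcave markov {a} {b} coprime 1≤a 5a≤3b k 2+k≤N =
    line-logConcave-4≤b markov coprime 1≤a 5a≤3b (5a≤3b⇒4≤b {a} {b} 5a≤3b (five≤a+b {a} {b} 2+k≤N)) k 2+k≤N

open import Data.Nat using (ℕ; _≤_; _*_; _+_; _∸_; _≤?_)
open import Data.Nat.Properties using (<⇒≤)
open import Data.Nat.Coprimality using (Coprime)
open import Defs
open Inequalities using (5a≤3b⇒a<b)
open Windows using (logConcave-window)
open LineCoefficients using (line; line-logConcave; above-line-upward)

-- The hypothesis 1 ≤ b is implied by 1 ≤ a and 5a ≤ 3b.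
theorem6p7 : (P : ℕ → ℕ → Series) → IsMarkovNumerators P →
    (a b : ℕ) → 1 ≤ a → 1 ≤ b → Coprime a b → 5 * a ≤ 3 * b →
    LogConcave (lineSeq P a b)
theorem6p7 P markov a b 1≤a _ coprime 5a≤3b =
  logConcave-window (line P a b) (a + b ∸ 3) (line-logConcave markov coprime 1≤a 5a≤3b)
    (λ i → a * b ≤? i * b + (a + b ∸ 3 ∸ i) * a)
    (above-line-upward (a + b ∸ 3) (<⇒≤ (5a≤3b⇒a<b 1≤a 5a≤3b)))
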